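{- A finite group $\Gamma$ is closed under polymatroid duality if and only if $\Gamma$ is abelian.
   Context: For a positive integer $n$ and a subgroup $\mathcal{H}\le\Gamma^n$, let $P(\mathcal{H})=([n],r_{\mathcal{H}})$ with $r_{\mathcal{H}}(S)=\log_{|\Gamma|}|\pi_S(\mathcal{H})|$, where $\pi_S:\Gamma^n\to\Gamma^S$ is the coordinate projection ($\pi_\emptyset(\mathcal H)$ trivial). Its dual is $P^*(\mathcal{H})=([n],r^*_{\mathcal{H}})$ with $r^*_{\mathcal{H}}(S)=r_{\mathcal{H}}([n]-S)+|S|-r_{\mathcal{H}}([n])$. $\Gamma$ is closed under polymatroid duality if for every $n$ and every subgroup $\mathcal{H}\le\Gamma^n$ there exists a subgroup $\mathcal{H}'\le\Gamma^n$ with $P^*(\mathcal{H})=P(\mathcal{H}')$. -}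

module Defs where

open import Data.Nat using (ℕ; zero; suc; _*_; _^_; _≤_)
open import Data.Fin using (Fin)
open import Data.Fin.Properties using (_≟_)
open import Data.Fin.Subset using (Subset; ∣_∣; ∁; ⊤)
open import Data.Bool using (Bool; true; false; if_then_else_; T)
open import Data.Maybe using (Maybe; just; nothing)
import Data.Maybe.Properties as MaybeP
open import Data.Vec using (Vec; []; _∷_; replicate; zipWith)
import Data.Vec as Vec
import Data.Vec.Properties as VecP
open import Data.List using (List; [_]; map; concatMap; allFin; filter; length; deduplicate)
open import Data.Product using (Σ; _,_)
open import Relation.Binary.PropositionalEquality using (_≡_)
open import Relation.Nullary.Decidable using (T?)
open import Algebra.Core using (Op₁; Op₂)
open import Algebra.Structures using (IsGroup)
open import Algebra.Definitions using (Commutative)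

-- A finite group Γ of order m, presented on the carrier Fin m with
-- propositional equality (every finite group is isomorphic to one of these).
record FiniteGroup : Set where
  field
    order   : ℕ
    _∙_     : Op₂ (Fin order)
    ε       : Fin order
    _⁻¹     : Op₁ (Fin order)
    isGroup : IsGroup _≡_ _∙_ ε _⁻¹

IsAbelian : FiniteGroup → Set
IsAbelian Γ = Commutative _≡_ _∙_
  where open FiniteGroup Γ

Elem : FiniteGroup → ℕ → Set
Elem Γ n = Vec (Fin (FiniteGroup.order Γ)) n

record Subgroup (Γ : FiniteGroup) (n : ℕ) : Set where
  open FiniteGroup Γ
  field
    mem    : Elem Γ n → Bool
    mem-ε  : T (mem (replicate n ε))
    mem-∙  : ∀ x y → T (mem x) → T (mem y) → T (mem (zipWith _∙_ x y))
    mem-⁻¹ : ∀ x → T (mem x) → T (mem (Vec.map _⁻¹ x))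

allVecs : (m n : ℕ) → List (Vec (Fin m) n)
allVecs m zero    = [ [] ]
allVecs m (suc n) = concatMap (λ a → map (a ∷_) (allVecs m n)) (allFin m)

-- coordinate projection π_S : Γ^n → Γ^S; an element of Γ^S is represented
-- as a length-n vector with entries exactly at the coordinates in S.
project : ∀ {A : Set} {n} → Subset n → Vec A n → Vec (Maybe A) n
project S x = zipWith (λ b a → if b then just a else nothing) S x

projSize : ∀ {Γ : FiniteGroup} {n} → Subgroup Γ n → Subset n → ℕ
projSize {Γ} {n} H S =
  length (deduplicate (VecP.≡-dec (MaybeP.≡-dec _≟_))
           (map (project S) (filter (λ x → T? (Subgroup.mem H x))
                                    (allVecs (FiniteGroup.order Γ) n))))

-- P*(H) = P(H'), i.e. for all S ⊆ [n]:
--   r_{H'}(S) = r_H([n] - S) + |S| - r_H([n])  with r = log_{|Γ|} |π_S(·)|,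
-- written after exponentiating with base |Γ| (and clearing the denominator):
--   |π_S(H')| · |π_[n](H)| = |π_{[n]-S}(H)| · |Γ|^{|S|}.
DualIs : ∀ {Γ : FiniteGroup} {n} → Subgroup Γ n → Subgroup Γ n → Set
DualIs {Γ} {n} H H' = ∀ (S : Subset n) →
  projSize H' S * projSize H ⊤ ≡ projSize H (∁ S) * (FiniteGroup.order Γ ^ ∣ S ∣)

ClosedUnderDuality : FiniteGroup → Set
ClosedUnderDuality Γ = ∀ (n : ℕ) → 1 ≤ n → (H : Subgroup Γ n) → Σ (Subgroup Γ n) (λ H' → DualIs H H')

{-# OPTIONS --safe #-}
-- If Γ is closed under duality, let G realise the dual of the diagonal D ≤ Γ³. The rank
-- identities for D give |G| = |π₁₂ G| and π₂₃ G = π₁₃ G = Γ², so G contains elements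
-- (a, ε, x) and (ε, b, y); their two products agree in the first two coordinates, hence are
-- equal, and x ∙ y = y ∙ x.
--
-- Conversely, let Γ be abelian and M = |Γ|!, so that M · x = ε for all x. Characters into
-- ℤ/Mℤ extend from subgroups, which yields a nondegenerate bi-additive pairing Γ × Γ → ℤ/Mℤ:
-- split off the cyclic subgroup generated by an element of least nonzero value under a
-- character of largest image, and recurse on its kernel. For H ≤ Γⁿ take H' = Hᗮ for the
-- coordinatewise pairing. Then |K| · |Kᗮ| = |Γⁿ| for every K ≤ Γⁿ, and Hᗮ ∩ ker π_S = (H + V_S)ᗮ
-- with V_S the vectors supported on S, so |π_S(Hᗮ)| · |H| = |H + V_S| = |π_{∁S}(H)| · |Γ|^|S|.
module Submission where

open import Defs
open import Function.Bundles using (_⇔_; mk⇔)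
open import Algebra.Definitions using (Commutative)
open import Data.Nat.Base using (ℕ; NonZero)
open import Relation.Binary.PropositionalEquality using (_≡_)

module Counting where

  open import Data.Nat using (suc; _+_; _*_; _≤_; _<_)
  open import Data.Nat.Properties using (≤⇒≯; ≤-antisym; +-suc; module ≤-Reasoning)
  open import Function using (_∘_)
  open import Relation.Unary using (Decidable)
  open import Data.Fin using (Fin; zero; suc)
  open import Data.Fin.Properties using (injective⇒≤)
  open import Data.List using (List; []; _∷_; map; filter; length; lookup; deduplicate)
  open import Data.List.Properties using (length-map)
  open import Data.List.Relation.Unary.Any using (index; here; there)
  open import Data.List.Relation.Unary.Any.Properties using (lookup-index)
  import Data.List.Relation.Unary.All as All
  open import Data.List.Relation.Unary.All.Properties using (¬Any⇒All¬)
  open import Data.List.Relation.Unary.AllPairs using (_∷_)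
  open import Data.List.Relation.Unary.Unique.Propositional using (Unique)
  import Data.List.Relation.Unary.Unique.Propositional.Properties as Unique
  open import Data.List.Relation.Binary.Subset.Propositional using (_⊆_)
  open import Data.List.Membership.Propositional using (_∈_; _∉_)
  open import Data.List.Membership.Propositional.Properties using (∈-lookup; ∈-map⁺; ∈-map⁻; ∈-filter⁻; ∈-deduplicate⁺; ∈-deduplicate⁻)
  open import Data.Product using (∃; _×_; _,_)
  open import Data.Empty using (⊥-elim)
  open import Relation.Nullary using (yes; no; ¬?; contradiction)
  open import Relation.Binary.Definitions using (DecidableEquality)
  open import Relation.Binary.PropositionalEquality

  module _ {A : Set} where

    Unique-lookup-injective : ∀ {xs : List A} → Unique xs →
                              ∀ {i j} → lookup xs i ≡ lookup xs j → i ≡ j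
    Unique-lookup-injective (_ ∷ _)     {zero}  {zero}  _  = refl
    Unique-lookup-injective (x∉xs ∷ _)  {zero}  {suc j} eq = ⊥-elim (All.lookup x∉xs (∈-lookup j) eq)
    Unique-lookup-injective (x∉xs ∷ _)  {suc i} {zero}  eq = ⊥-elim (All.lookup x∉xs (∈-lookup i) (sym eq))
    Unique-lookup-injective (_ ∷ u)     {suc i} {suc j} eq = cong suc (Unique-lookup-injective u eq)

    Unique-⊆⇒length≤ : ∀ {xs ys : List A} → Unique xs → xs ⊆ ys → length xs ≤ length ys
    Unique-⊆⇒length≤ {xs} {ys} u xs⊆ys = injective⇒≤ position-injective
      where
      position : Fin (length xs) → Fin (length ys)
      position i = index (xs⊆ys (∈-lookup i))

      position-injective : ∀ {i j} → position i ≡ position j → i ≡ j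
      position-injective {i} {j} eq = Unique-lookup-injective u (begin
        lookup xs i            ≡⟨ lookup-index (xs⊆ys (∈-lookup i)) ⟩
        lookup ys (position i) ≡⟨ cong (lookup ys) eq ⟩
        lookup ys (position j) ≡⟨ lookup-index (xs⊆ys (∈-lookup j)) ⟨
        lookup xs j            ∎)
        where open ≡-Reasoning

    Unique-⊆⇒length< : ∀ {xs ys : List A} {y} → Unique xs → xs ⊆ ys → y ∈ ys → y ∉ xs →
                       length xs < length ys
    Unique-⊆⇒length< {xs} u xs⊆ys y∈ys y∉xs = Unique-⊆⇒length≤ (¬Any⇒All¬ xs y∉xs ∷ u) λ where
      (here refl)   → y∈ys
      (there x∈xs) → xs⊆ys x∈xs

    Unique-⊆-⊇⇒length≡ : ∀ {xs ys : List A} → Unique xs → Unique ys → xs ⊆ ys → ys ⊆ xs →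
                          length xs ≡ length ys
    Unique-⊆-⊇⇒length≡ uxs uys xs⊆ys ys⊆xs =
      ≤-antisym (Unique-⊆⇒length≤ uxs xs⊆ys) (Unique-⊆⇒length≤ uys ys⊆xs)

  module _ {A B : Set} where

    Unique-injection⇒length≤ : ∀ {xs : List A} {ys : List B} (h : A → B) →
                               (∀ {x y} → h x ≡ h y → x ≡ y) → Unique xs →
                               (∀ {x} → x ∈ xs → h x ∈ ys) → length xs ≤ length ys
    Unique-injection⇒length≤ {xs} {ys} h h-injective u h∈ys = begin
      length xs         ≡⟨ length-map h xs ⟨
      length (map h xs) ≤⟨ Unique-⊆⇒length≤ (Unique.map⁺ h-injective u) mapped⊆ ⟩
      length ys         ∎
      where
      open ≤-Reasoning
      mapped⊆ : map h xs ⊆ ys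
      mapped⊆ y∈ with x , x∈xs , refl ← ∈-map⁻ h y∈ = h∈ys x∈xs


  module _ {A : Set} (_≟_ : DecidableEquality A) where
    open import Data.List.Membership.DecPropositional _≟_ using (_∈?_)

    Unique-⊆-length≥⇒⊇ : ∀ {xs ys : List A} → Unique xs → xs ⊆ ys → length ys ≤ length xs → ys ⊆ xs
    Unique-⊆-length≥⇒⊇ {xs} u xs⊆ys ys≤xs {y} y∈ys with y ∈? xs
    ... | yes y∈xs = y∈xs
    ... | no  y∉xs = contradiction (Unique-⊆⇒length< u xs⊆ys y∈ys y∉xs) (≤⇒≯ ys≤xs)

    image : {B : Set} → (B → A) → List B → List A
    image f xs = deduplicate _≟_ (map f xs)

    module _ {B : Set} {f : B → A} where

      image-Unique : ∀ xs → Unique (image f xs)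
      image-Unique xs = deduplicate-! (map f xs)
        where open import Data.List.Relation.Unary.Unique.DecPropositional.Properties _≟_ using (deduplicate-!)

      ∈-image⁺ : ∀ {xs x} → x ∈ xs → f x ∈ image f xs
      ∈-image⁺ x∈xs = ∈-deduplicate⁺ _≟_ (∈-map⁺ f x∈xs)

      ∈-image⁻ : ∀ {xs y} → y ∈ image f xs → ∃ λ x → x ∈ xs × y ≡ f x
      ∈-image⁻ {xs} y∈ = ∈-map⁻ f (∈-deduplicate⁻ _≟_ (map f xs) y∈)

      length-image≤ : ∀ {xs ys} → image f xs ⊆ ys → length (image f xs) ≤ length ys
      length-image≤ = Unique-⊆⇒length≤ (image-Unique _)

      length-image-injective : (∀ {x y} → f x ≡ f y → x ≡ y) → ∀ {xs} → Unique xs → length (image f xs) ≡ length xs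
      length-image-injective f-injective {xs} u = trans
        (Unique-⊆-⊇⇒length≡ (image-Unique xs) (Unique.map⁺ f-injective u)
          (∈-deduplicate⁻ _≟_ (map f xs)) (∈-deduplicate⁺ _≟_))
        (length-map f xs)

  module _ {X : Set} {P : X → Set} (P? : Decidable P) where

    length-filter-split : ∀ xs → length xs ≡ length (filter P? xs) + length (filter (¬? ∘ P?) xs)
    length-filter-split [] = refl
    length-filter-split (x ∷ xs) with P? x
    ... | yes _ = cong suc (length-filter-split xs)
    ... | no  _ = trans (cong suc (length-filter-split xs)) (sym (+-suc _ _))

    filter-absorb : {Q : X → Set} (Q? : Decidable Q) → (∀ {x} → P x → Q x) → ∀ xs → filter P? (filter Q? xs) ≡ filter P? xs
    filter-absorb Q? P⇒Q [] = refl
    filter-absorb Q? P⇒Q (x ∷ xs) with Q? x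
    ... | yes _ with P? x
    ...   | yes _ = cong (x ∷_) (filter-absorb Q? P⇒Q xs)
    ...   | no  _ = filter-absorb Q? P⇒Q xs
    filter-absorb Q? P⇒Q (x ∷ xs) | no ¬q with P? x
    ...   | yes p = contradiction (P⇒Q p) ¬q
    ...   | no  _ = filter-absorb Q? P⇒Q xs

  module _ {X B : Set} (_≟_ : DecidableEquality B) (g : X → B) where

    fibre : B → List X → List X
    fibre b = filter (λ v → g v ≟ b)

    length-by-fibres : ∀ (I : List B) (L : List X) {c} → Unique I → (∀ {v} → v ∈ L → g v ∈ I) →
                       (∀ {b} → b ∈ I → length (fibre b L) ≡ c) → length L ≡ length I * c
    length-by-fibres [] [] _ _ _ = refl
    length-by-fibres [] (v ∷ L) _ g∈I _ with () ← g∈I (here refl)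
    length-by-fibres (b ∷ I) L {c} (b∉I ∷ uI) g∈I fibres = begin
      length L                          ≡⟨ length-filter-split (λ v → g v ≟ b) L ⟩
      length (fibre b L) + length rest  ≡⟨ cong₂ _+_ (fibres (here refl)) rest-by-fibres ⟩
      c + length I * c                  ∎
      where
      open ≡-Reasoning
      rest : List X
      rest = filter (λ v → ¬? (g v ≟ b)) L
      rest-by-fibres : length rest ≡ length I * c
      rest-by-fibres = length-by-fibres I rest uI g∈I′ fibres′
        where
        g∈I′ : ∀ {v} → v ∈ rest → g v ∈ I
        g∈I′ v∈ with v∈L , gv≢b ← ∈-filter⁻ (λ v → ¬? (g v ≟ b)) v∈ with g∈I v∈L
        ... | here gv≡b = contradiction gv≡b gv≢b
        ... | there gv∈I = gv∈I
        fibres′ : ∀ {b′} → b′ ∈ I → length (fibre b′ rest) ≡ c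
        fibres′ {b′} b′∈I = trans (cong length (filter-absorb (λ v → g v ≟ b′) (λ v → ¬? (g v ≟ b))
                                    (λ gv≡b′ gv≡b → All.lookup b∉I b′∈I (trans (sym gv≡b) gv≡b′)) L))
                                  (fibres (there b′∈I))

module EnumeratedGroups where

  open import Algebra.Core using (Op₁; Op₂)
  open import Algebra.Structures using (IsGroup)
  open import Algebra.Bundles using (Group)
  import Algebra.Definitions.RawMonoid as RawMonoid
  open import Data.Bool using (Bool; true; T; _∧_)
  open import Data.Bool.Properties using (T-∧)
  open import Data.Nat using (ℕ; zero; suc; _*_; _≤_; _<_)
  open import Data.Nat.Properties using (≤-antisym; *-comm; <⇒≱)
  open import Data.List using (List; []; _∷_; filter; length)
  open import Data.List.Relation.Unary.Unique.Propositional using (Unique)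
  import Data.List.Relation.Unary.Unique.Propositional.Properties as Unique
  open import Data.List.Membership.Propositional using (_∈_)
  open import Data.List.Membership.Propositional.Properties using (∈-filter⁺; ∈-filter⁻)
  open import Data.List.Relation.Unary.Any using (here)
  open import Data.Product using (_×_; _,_; proj₂)
  open import Function using (_∘_; _⇔_; Equivalence)
  open import Relation.Nullary using (¬_; yes; no; contradiction)
  open import Relation.Nullary.Decidable using (T?; isYes; toWitness; fromWitness)
  open import Relation.Binary.Definitions using (DecidableEquality)
  open import Relation.Binary.PropositionalEquality
  open Counting

  record EnumeratedGroup : Set₁ where
    infixl 7 _∙_
    infix 8 _⁻¹
    field
      Carrier         : Set
      _≟_             : DecidableEquality Carrier
      _∙_             : Op₂ Carrier
      ε               : Carrier
      _⁻¹             : Op₁ Carrier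
      isGroup         : IsGroup _≡_ _∙_ ε _⁻¹
      elements        : List Carrier
      ∈-elements      : ∀ x → x ∈ elements
      elements-Unique : Unique elements

    open IsGroup isGroup public using (assoc; identityˡ; identityʳ; inverseˡ; inverseʳ; _\\_; _//_)

    group : Group _ _
    group = record { isGroup = isGroup }

    infixr 8 _·_
    _·_ : ℕ → Carrier → Carrier
    _·_ = RawMonoid._×_ (Group.rawMonoid group)

  IsCommutativeGroup : EnumeratedGroup → Set
  IsCommutativeGroup G = Commutative _≡_ (EnumeratedGroup._∙_ G)

  AnnihilatedBy : EnumeratedGroup → ℕ → Set
  AnnihilatedBy G M = ∀ x → EnumeratedGroup._·_ G M x ≡ EnumeratedGroup.ε G

  module Subgroups (G : EnumeratedGroup) where
    open EnumeratedGroup G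
    open import Algebra.Properties.Group group using (\\-leftDividesʳ; ∙-cancelˡ)

    record DecSubgroup : Set where
      field
        mem    : Carrier → Bool
        mem-ε  : T (mem ε)
        mem-∙  : ∀ {x y} → T (mem x) → T (mem y) → T (mem (x ∙ y))
        mem-⁻¹ : ∀ {x} → T (mem x) → T (mem (x ⁻¹))
    open DecSubgroup public

    ·-ε : ∀ a → a · ε ≡ ε
    ·-ε zero    = refl
    ·-ε (suc a) = trans (identityˡ (a · ε)) (·-ε a)

    infix 4 _∈ₛ_
    _∈ₛ_ : Carrier → DecSubgroup → Set
    x ∈ₛ K = T (mem K x)

    module _ (K : DecSubgroup) where

      mem-// : ∀ {x y} → x ∈ₛ K → y ∈ₛ K → x // y ∈ₛ K
      mem-// x∈K y∈K = mem-∙ K x∈K (mem-⁻¹ K y∈K)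

      mem-· : ∀ a {x} → x ∈ₛ K → a · x ∈ₛ K
      mem-· zero    x∈K = mem-ε K
      mem-· (suc a) x∈K = mem-∙ K x∈K (mem-· a x∈K)

    members : (Carrier → Bool) → List Carrier
    members P = filter (λ x → T? (P x)) elements

    card : (Carrier → Bool) → ℕ
    card P = length (members P)

    module _ (P : Carrier → Bool) where

      members-Unique : Unique (members P)
      members-Unique = Unique.filter⁺ (λ x → T? (P x)) elements-Unique

      ∈-members⁺ : ∀ {x} → T (P x) → x ∈ members P
      ∈-members⁺ {x} = ∈-filter⁺ (λ x → T? (P x)) (∈-elements x)

      ∈-members⁻ : ∀ {x} → x ∈ members P → T (P x)
      ∈-members⁻ x∈ = proj₂ (∈-filter⁻ (λ x → T? (P x)) {xs = elements} x∈)

    module _ {P Q : Carrier → Bool} where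

      card-mono : (∀ {x} → T (P x) → T (Q x)) → card P ≤ card Q
      card-mono P⇒Q = Unique-⊆⇒length≤ (members-Unique P) (λ x∈ → ∈-members⁺ Q (P⇒Q (∈-members⁻ P x∈)))

      card-mono-< : ∀ {g} → (∀ {x} → T (P x) → T (Q x)) → T (Q g) → ¬ T (P g) → card P < card Q
      card-mono-< P⇒Q Qg ¬Pg = Unique-⊆⇒length< (members-Unique P)
        (λ x∈ → ∈-members⁺ Q (P⇒Q (∈-members⁻ P x∈))) (∈-members⁺ Q Qg) (λ g∈ → ¬Pg (∈-members⁻ P g∈))

    card-cong : ∀ {P Q} → (∀ {x} → T (P x) → T (Q x)) → (∀ {x} → T (Q x) → T (P x)) → card P ≡ card Q
    card-cong P⇒Q Q⇒P = ≤-antisym (card-mono P⇒Q) (card-mono Q⇒P)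

    full : DecSubgroup
    full = record { mem = λ _ → true ; mem-ε = _ ; mem-∙ = λ _ _ → _ ; mem-⁻¹ = λ _ → _ }

    trivial : DecSubgroup
    trivial = record
      { mem    = λ x → isYes (x ≟ ε)
      ; mem-ε  = fromWitness refl
      ; mem-∙  = λ x≡ε y≡ε → fromWitness (trans (cong₂ _∙_ (toWitness x≡ε) (toWitness y≡ε)) (identityˡ ε))
      ; mem-⁻¹ = λ x≡ε → fromWitness (trans (cong _⁻¹ (toWitness x≡ε)) ε⁻¹≈ε)
      }
      where open import Algebra.Properties.Group group using (ε⁻¹≈ε)

    card-trivial : card (mem trivial) ≡ 1
    card-trivial = Unique-⊆-⊇⇒length≡ (members-Unique (mem trivial)) (All.[] AllPairs.∷ AllPairs.[])
      (λ x∈ → here (toWitness (∈-members⁻ (mem trivial) x∈)))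
      (λ { (here refl) → ∈-members⁺ (mem trivial) (fromWitness refl) })
      where import Data.List.Relation.Unary.All as All
            import Data.List.Relation.Unary.AllPairs as AllPairs

    card≤1⇒only-ε : ∀ {P} → T (P ε) → card P ≤ 1 → ∀ {x} → T (P x) → x ≡ ε
    card≤1⇒only-ε {P} Pε card≤1 {x} Px with x ≟ ε
    ... | yes x≡ε = x≡ε
    ... | no  x≢ε = contradiction card≤1 (<⇒≱ (subst (_< card P) card-trivial
          (card-mono-< (λ y≡ε → subst (T ∘ P) (sym (toWitness y≡ε)) Pε) Px (x≢ε ∘ toWitness))))

    module _ {B : Set} (_≟B_ : DecidableEquality B) (K : DecSubgroup) (f : Carrier → B) where

      kernelIn : Carrier → Bool
      kernelIn v = mem K v ∧ isYes (f v ≟B f ε)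

      card≡card-kernel*image : (∀ {v w} → v ∈ₛ K → w ∈ₛ K → f v ≡ f w ⇔ f (v \\ w) ≡ f ε) →
                               card (mem K) ≡ card kernelIn * length (image _≟B_ f (members (mem K)))
      card≡card-kernel*image f-cosets = trans
        (length-by-fibres _≟B_ f (image _≟B_ f L) L (image-Unique _≟B_ L) (∈-image⁺ _≟B_) fibre-size)
        (*-comm _ (card kernelIn))
        where
        L : List Carrier
        L = members (mem K)

        fibreOf : B → List Carrier
        fibreOf b = fibre _≟B_ f b L

        ∈-fibre⁺ : ∀ {w b} → w ∈ₛ K → f w ≡ b → w ∈ fibreOf b
        ∈-fibre⁺ {b = b} w∈K fw≡b = ∈-filter⁺ (λ v → f v ≟B b) (∈-members⁺ (mem K) w∈K) fw≡b

        ∈-fibre⁻ : ∀ {w b} → w ∈ fibreOf b → w ∈ₛ K × f w ≡ b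
        ∈-fibre⁻ {b = b} w∈ with w∈L , fw≡b ← ∈-filter⁻ (λ v → f v ≟B b) {xs = L} w∈ =
          ∈-members⁻ (mem K) w∈L , fw≡b

        fibre-Unique : ∀ b → Unique (fibreOf b)
        fibre-Unique b = Unique.filter⁺ (λ v → f v ≟B b) (members-Unique (mem K))

        translate : ∀ {v₀} → v₀ ∈ₛ K → length (fibreOf (f ε)) ≤ length (fibreOf (f v₀))
        translate {v₀} v₀∈K = Unique-injection⇒length≤ (v₀ ∙_) (∙-cancelˡ v₀ _ _) (fibre-Unique (f ε)) λ w∈ →
          let w∈K , fw≡fε = ∈-fibre⁻ w∈
          in ∈-fibre⁺ (mem-∙ K v₀∈K w∈K)
               (sym (Equivalence.from (f-cosets v₀∈K (mem-∙ K v₀∈K w∈K))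
                      (trans (cong f (\\-leftDividesʳ v₀ _)) fw≡fε)))

        untranslate : ∀ {v₀} → v₀ ∈ₛ K → length (fibreOf (f v₀)) ≤ length (fibreOf (f ε))
        untranslate {v₀} v₀∈K = Unique-injection⇒length≤ (v₀ \\_) (∙-cancelˡ (v₀ ⁻¹) _ _) (fibre-Unique (f v₀)) λ w∈ →
          let w∈K , fw≡fv₀ = ∈-fibre⁻ w∈
          in ∈-fibre⁺ (mem-∙ K (mem-⁻¹ K v₀∈K) w∈K) (Equivalence.to (f-cosets v₀∈K w∈K) (sym fw≡fv₀))

        kernel-fibre : length (fibreOf (f ε)) ≡ card kernelIn
        kernel-fibre = Unique-⊆-⊇⇒length≡ (fibre-Unique (f ε)) (members-Unique kernelIn)
          (λ w∈ → let w∈K , fw≡fε = ∈-fibre⁻ w∈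
                  in ∈-members⁺ kernelIn (Equivalence.from T-∧ (w∈K , fromWitness fw≡fε)))
          (λ w∈ → let w∈K , fw≡fε = Equivalence.to T-∧ (∈-members⁻ kernelIn w∈)
                  in ∈-fibre⁺ w∈K (toWitness fw≡fε))

        fibre-size : ∀ {b} → b ∈ image _≟B_ f L → length (fibreOf b) ≡ card kernelIn
        fibre-size b∈ with v₀ , v₀∈L , refl ← ∈-image⁻ _≟B_ b∈ =
          let v₀∈K = ∈-members⁻ (mem K) v₀∈L
          in trans (≤-antisym (untranslate v₀∈K) (translate v₀∈K)) kernel-fibre

open EnumeratedGroups using (EnumeratedGroup; module EnumeratedGroup; IsCommutativeGroup; AnnihilatedBy)

module ModularArithmetic where

  open import Data.Nat using (ℕ; zero; suc; _+_; _*_; _∸_; _<_; s≤s; _%_; _/_; NonZero; >-nonZero⁻¹)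
  open import Data.Nat.Properties
    using (+-comm; +-assoc; +-identityʳ; _≟_; m+[n∸m]≡n; *-identityˡ; *-comm; *-assoc; *-cancelʳ-≡; *-cancelʳ-<;
           *-monoˡ-<; m*n≢0⇒m≢0)
  open import Data.List using (List; map; upTo; length)
  open import Data.List.Properties using (length-map; length-upTo)
  open import Data.List.Membership.Propositional using (_∈_)
  open import Data.List.Membership.Propositional.Properties using (∈-map⁺; ∈-map⁻; ∈-upTo⁺; ∈-upTo⁻)
  open import Data.List.Relation.Unary.Unique.Propositional using (Unique)
  import Data.List.Relation.Unary.Unique.Propositional.Properties as Unique
  open import Data.Product using (∃; _×_; _,_)
  open import Data.Nat.DivMod
  open import Data.Nat.Divisibility using (_∣_; m%n≡0⇒n∣m)
  open import Relation.Binary.Bundles using (Setoid)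
  import Relation.Binary.Reasoning.Setoid as SetoidReasoning
  open import Relation.Binary.Definitions using (Decidable)
  open import Relation.Binary.PropositionalEquality
  open import Function using (_∘_)
  open import Relation.Nullary using (¬_; yes; no)
  import Relation.Unary

  least-witness : ∀ {P : ℕ → Set} → Relation.Unary.Decidable P → ∀ {n} → P n →
                  ∃ λ k → P k × (∀ {j} → j < k → ¬ P j)
  least-witness P? {zero} p0 = 0 , p0 , λ ()
  least-witness P? {suc n} pn with P? 0
  ... | yes p0 = 0 , p0 , λ ()
  ... | no ¬p0 with k , pk , below ← least-witness (P? ∘ suc) pn =
    suc k , pk , λ { {zero} _ → ¬p0 ; {suc j} (s≤s j<k) → below j<k }

  multiples : ℕ → ℕ → List ℕ
  multiples t d = map (_* t) (upTo d)

  module _ {t d : ℕ} where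

    length-multiples : length (multiples t d) ≡ d
    length-multiples = trans (length-map (_* t) (upTo d)) (length-upTo d)

    multiples-Unique : .{{NonZero t}} → Unique (multiples t d)
    multiples-Unique = Unique.map⁺ (λ {a} {b} → *-cancelʳ-≡ a b t) (Unique.upTo⁺ d)

    ∈-multiples⁺ : ∀ {a} → a < d → a * t ∈ multiples t d
    ∈-multiples⁺ a<d = ∈-map⁺ (_* t) (∈-upTo⁺ a<d)

    ∈-multiples⁻ : ∀ {c} → c ∈ multiples t d → ∃ λ a → a < d × c ≡ a * t
    ∈-multiples⁻ c∈ with a , a∈ , refl ← ∈-map⁻ (_* t) c∈ = a , ∈-upTo⁻ a∈ , refl

  module Modulo (M : ℕ) .{{M≢0 : NonZero M}} where

    -- ℤ/Mℤ is modelled by ℕ up to equality of residues; characters take their values there.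
    infix 4 _≈_
    _≈_ : ℕ → ℕ → Set
    a ≈ b = a % M ≡ b % M

    _≈?_ : Decidable _≈_
    a ≈? b = a % M ≟ b % M

    ≈-setoid : Setoid _ _
    ≈-setoid = record
      { Carrier = ℕ ; _≈_ = _≈_ ; isEquivalence = record { refl = refl ; sym = sym ; trans = trans } }

    module ≈-Reasoning = SetoidReasoning ≈-setoid

    %-≈ : ∀ a → a % M ≈ a
    %-≈ a = m%n%n≡m%n a M

    +-cong : ∀ {a b c d} → a ≈ b → c ≈ d → a + c ≈ b + d
    +-cong {a} {b} {c} {d} a≈b c≈d = begin
      (a + c) % M           ≡⟨ %-distribˡ-+ a c M ⟩
      (a % M + c % M) % M   ≡⟨ cong₂ (λ x y → (x + y) % M) a≈b c≈d ⟩
      (b % M + d % M) % M   ≡⟨ %-distribˡ-+ b d M ⟨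
      (b + d) % M           ∎
      where open ≡-Reasoning

    *-congˡ : ∀ k {a b} → a ≈ b → k * a ≈ k * b
    *-congˡ k {a} {b} a≈b = begin
      (k * a) % M             ≡⟨ %-distribˡ-* k a M ⟩
      (k % M * (a % M)) % M   ≡⟨ cong (λ x → (k % M * x) % M) a≈b ⟩
      (k % M * (b % M)) % M   ≡⟨ %-distribˡ-* k b M ⟨
      (k * b) % M             ∎
      where open ≡-Reasoning

    +-multiple : ∀ a k → a + k * M ≈ a
    +-multiple a k = [m+kn]%n≡m%n a k M

    multiple≈0 : ∀ k → k * M ≈ 0
    multiple≈0 k = +-multiple 0 k

    M≈0 : M ≈ 0
    M≈0 = subst (_≈ 0) (*-identityˡ M) (multiple≈0 1)

    +-inverse : ∀ c → c + (M ∸ c % M) ≈ 0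
    +-inverse c = begin
      c + (M ∸ c % M)       ≈⟨ +-cong (%-≈ c) refl ⟨
      c % M + (M ∸ c % M)   ≡⟨ m+[n∸m]≡n (m%n≤n c M) ⟩
      M                     ≈⟨ M≈0 ⟩
      0                     ∎
      where open ≈-Reasoning

    +-cancelʳ : ∀ {a b} c → a + c ≈ b + c → a ≈ b
    +-cancelʳ {a} {b} c a+c≈b+c = begin
      a                ≡⟨ +-identityʳ a ⟨
      a + 0            ≈⟨ +-cong {a} refl (+-inverse c) ⟨
      a + (c + c⁻)     ≡⟨ +-assoc a c c⁻ ⟨
      a + c + c⁻       ≈⟨ +-cong a+c≈b+c refl ⟩
      b + c + c⁻       ≡⟨ +-assoc b c c⁻ ⟩
      b + (c + c⁻)     ≈⟨ +-cong {b} refl (+-inverse c) ⟩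
      b + 0            ≡⟨ +-identityʳ b ⟩
      b                ∎
      where
      open ≈-Reasoning
      c⁻ : ℕ
      c⁻ = M ∸ c % M

    +-cancelˡ : ∀ {a b} c → c + a ≈ c + b → a ≈ b
    +-cancelˡ {a} {b} c c+a≈c+b = +-cancelʳ c (subst₂ _≈_ (+-comm c a) (+-comm c b) c+a≈c+b)

    0%M≡0 : 0 % M ≡ 0
    0%M≡0 = m<n⇒m%n≡m (>-nonZero⁻¹ M)

    ≈0⇒∣ : ∀ {a} → a ≈ 0 → M ∣ a
    ≈0⇒∣ {a} a≈0 = m%n≡0⇒n∣m a M (trans a≈0 0%M≡0)

    module Divisor {d : ℕ} .{{d≢0 : NonZero d}} (d∣M : d ∣ M) where

      M≡[M/d]*d : M ≡ M / d * d
      M≡[M/d]*d = sym (m/n*n≡m d∣M)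

      instance
        M/d≢0 : NonZero (M / d)
        M/d≢0 = m*n≢0⇒m≢0 (M / d) {{subst NonZero M≡[M/d]*d M≢0}}

      multiple<M : ∀ {a} → a < d → a * (M / d) < M
      multiple<M {a} a<d = subst (a * (M / d) <_) (trans (*-comm d (M / d)) (sym M≡[M/d]*d)) (*-monoˡ-< (M / d) a<d)

      annihilated⇒multiple : ∀ {c} → c < M → d * c ≈ 0 → c ∈ multiples (M / d) d
      annihilated⇒multiple {c} c<M d*c≈0 = subst (_∈ multiples (M / d) d) (sym c≡k*[M/d]) (∈-multiples⁺ k<d)
        where
        k : ℕ
        k = _∣_.quotient (≈0⇒∣ d*c≈0)
        c≡k*[M/d] : c ≡ k * (M / d)
        c≡k*[M/d] = *-cancelʳ-≡ c (k * (M / d)) d (begin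
          c * d               ≡⟨ *-comm c d ⟩
          d * c               ≡⟨ _∣_.equality (≈0⇒∣ d*c≈0) ⟩
          k * M               ≡⟨ cong (k *_) M≡[M/d]*d ⟩
          k * (M / d * d)     ≡⟨ *-assoc k (M / d) d ⟨
          k * (M / d) * d     ∎)
          where open ≡-Reasoning
        k<d : k < d
        k<d = *-cancelʳ-< (M / d) k d (subst₂ _<_ c≡k*[M/d] (trans M≡[M/d]*d (*-comm (M / d) d)) c<M)

module Characters (G : EnumeratedGroup) (comm : IsCommutativeGroup G)
                  (M : ℕ) .{{M≢0 : NonZero M}} (M-annihilates : AnnihilatedBy G M) where

  open EnumeratedGroup G
  open import Algebra.Bundles using (AbelianGroup)
  open import Data.Bool using (Bool; T)
  open import Data.Nat using (ℕ; zero; suc; _+_; _*_; _∸_; _≤_; _<_; z≤n; s≤s; _%_; _/_; NonZero; >-nonZero⁻¹)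
  open import Data.Nat.Properties renaming (_≟_ to _≟ℕ_)
  open import Data.Nat.DivMod using (m≡m%n+[m/n]*n; m%n<n; m/n*n≡m; m<n⇒m%n≡m)
  open import Data.Nat.Divisibility using (_∣_; divides; m%n≡0⇒n∣m)
  import Algebra.Properties.CommutativeSemigroup +-commutativeSemigroup as ℕ+
  import Algebra.Properties.CommutativeSemigroup *-commutativeSemigroup as ℕ*
  open import Data.List using (List; []; _∷_; upTo; length)
  open import Data.List.Membership.Propositional using (_∈_)
  open import Data.List.Membership.Propositional.Properties using (∈-upTo⁺)
  open import Data.List.Relation.Unary.Any as Any using (Any; here; there; any?)
  open import Data.List.Relation.Unary.Any.Properties using (lookup-result)
  open import Data.Product using (∃; _×_; _,_; proj₁; proj₂)
  open import Data.Sum using (inj₁; inj₂)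
  open import Function using (_∘_; mk⇔; Equivalence)
  open import Data.Bool.Properties using (T-∧)
  open import Relation.Nullary using (¬_; Dec; yes; no; contradiction)
  open import Relation.Nullary.Decidable using (T?; isYes; fromWitness)
  open import Relation.Binary.PropositionalEquality
  open Counting
  open EnumeratedGroups
  open ModularArithmetic

  open Subgroups G
  open Modulo M

  abelianGroup : AbelianGroup _ _
  abelianGroup = record { isAbelianGroup = record { isGroup = isGroup ; comm = comm } }

  open import Algebra.Properties.AbelianGroup abelianGroup using (⁻¹-∙-comm)
  open import Algebra.Properties.Group group
    using (ε⁻¹≈ε; //-rightDividesˡ; //-rightDividesʳ; \\-leftDividesˡ; \\-leftDividesʳ; inverseʳ-unique)
  open import Algebra.Properties.CommutativeMonoid.Mult (AbelianGroup.commutativeMonoid abelianGroup)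
    using (×-homo-+; ×-assocˡ; ×-homo-1)
  open import Algebra.Properties.CommutativeSemigroup (AbelianGroup.commutativeSemigroup abelianGroup)
    using (interchange)

  //-ε : ∀ v → v // ε ≡ v
  //-ε v = trans (cong (v ∙_) ε⁻¹≈ε) (identityʳ v)

  //-∙-interchange : ∀ v p w q → (v // p) ∙ (w // q) ≡ (v ∙ w) // (p ∙ q)
  //-∙-interchange v p w q = trans (interchange v (p ⁻¹) w (q ⁻¹)) (cong ((v ∙ w) ∙_) (⁻¹-∙-comm p q))

  [v//pq]q≡v//p : ∀ v p q → (v // (p ∙ q)) ∙ q ≡ v // p
  [v//pq]q≡v//p v p q = begin
    (v ∙ (p ∙ q) ⁻¹) ∙ q          ≡⟨ cong (λ z → (v ∙ z) ∙ q) (⁻¹-∙-comm p q) ⟨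
    (v ∙ (p ⁻¹ ∙ q ⁻¹)) ∙ q       ≡⟨ assoc v _ q ⟩
    v ∙ ((p ⁻¹ ∙ q ⁻¹) ∙ q)       ≡⟨ cong (v ∙_) (assoc (p ⁻¹) (q ⁻¹) q) ⟩
    v ∙ (p ⁻¹ ∙ (q ⁻¹ ∙ q))       ≡⟨ cong (λ z → v ∙ (p ⁻¹ ∙ z)) (inverseˡ q) ⟩
    v ∙ (p ⁻¹ ∙ ε)                ≡⟨ cong (v ∙_) (identityʳ (p ⁻¹)) ⟩
    v // p                        ∎
    where open ≡-Reasoning

  ·-multiple-of-M : ∀ k x → (k * M) · x ≡ ε
  ·-multiple-of-M k x = trans (sym (×-assocˡ x k M)) (trans (cong (k ·_) (M-annihilates x)) (·-ε k))

  ·-%M : ∀ a x → (a % M) · x ≡ a · x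
  ·-%M a x = sym (begin
    a · x                           ≡⟨ cong (_· x) (m≡m%n+[m/n]*n a M) ⟩
    (a % M + a / M * M) · x         ≡⟨ ×-homo-+ x (a % M) (a / M * M) ⟩
    (a % M) · x ∙ (a / M * M) · x   ≡⟨ cong ((a % M) · x ∙_) (·-multiple-of-M (a / M) x) ⟩
    (a % M) · x ∙ ε                 ≡⟨ identityʳ _ ⟩
    (a % M) · x                     ∎)
    where open ≡-Reasoning

  ·-⁻¹ : ∀ a x → (a · x) ⁻¹ ≡ ((M ∸ 1) * a) · x
  ·-⁻¹ a x = sym (inverseʳ-unique (a · x) _ (begin
    a · x ∙ ((M ∸ 1) * a) · x   ≡⟨ ×-homo-+ x a ((M ∸ 1) * a) ⟨
    (suc (M ∸ 1) * a) · x       ≡⟨ cong (λ n → (n * a) · x) (m+[n∸m]≡n {1} {M} (>-nonZero⁻¹ M)) ⟩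
    (M * a) · x                 ≡⟨ cong (_· x) (*-comm M a) ⟩
    (a * M) · x                 ≡⟨ ·-multiple-of-M a x ⟩
    ε                           ∎))
    where open ≡-Reasoning

  record HomomorphismOn (K : DecSubgroup) (f : Carrier → ℕ) : Set where
    constructor mkHomomorphismOn
    field
      homo : ∀ {x y} → x ∈ₛ K → y ∈ₛ K → f (x ∙ y) ≈ f x + f y
  open HomomorphismOn public

  IsCharacter : (Carrier → ℕ) → Set
  IsCharacter = HomomorphismOn full

  record Pairing : Set where
    field
      ⟨_,_⟩          : Carrier → Carrier → ℕ
      linearˡ        : ∀ x x′ y → ⟨ x ∙ x′ , y ⟩ ≈ ⟨ x , y ⟩ + ⟨ x′ , y ⟩
      linearʳ        : ∀ x y y′ → ⟨ x , y ∙ y′ ⟩ ≈ ⟨ x , y ⟩ + ⟨ x , y′ ⟩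
      nondegenerateʳ : ∀ {y} → y ≢ ε → ∃ λ x → ¬ (⟨ x , y ⟩ ≈ 0)

  module _ {K : DecSubgroup} {f : Carrier → ℕ} (hom : HomomorphismOn K f) where
    open ≈-Reasoning

    hom-ε : f ε ≈ 0
    hom-ε = sym (+-cancelˡ (f ε) (begin
      f ε + 0     ≡⟨ +-identityʳ (f ε) ⟩
      f ε         ≡⟨ cong f (identityˡ ε) ⟨
      f (ε ∙ ε)   ≈⟨ homo hom (mem-ε K) (mem-ε K) ⟩
      f ε + f ε   ∎))

    hom-· : ∀ {x} → x ∈ₛ K → ∀ a → f (a · x) ≈ a * f x
    hom-· x∈K zero    = hom-ε
    hom-· {x} x∈K (suc a) = begin
      f (x ∙ a · x)     ≈⟨ homo hom x∈K (mem-· K a x∈K) ⟩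
      f x + f (a · x)   ≈⟨ +-cong {f x} refl (hom-· x∈K a) ⟩
      f x + a * f x     ∎

    hom-⁻¹ : ∀ {x} → x ∈ₛ K → f (x ⁻¹) + f x ≈ 0
    hom-⁻¹ {x} x∈K = begin
      f (x ⁻¹) + f x    ≈⟨ homo hom (mem-⁻¹ K x∈K) x∈K ⟨
      f (x ⁻¹ ∙ x)      ≡⟨ cong f (inverseˡ x) ⟩
      f ε               ≈⟨ hom-ε ⟩
      0                 ∎

    hom-// : ∀ {x y} → x ∈ₛ K → y ∈ₛ K → f (x // y) + f y ≈ f x
    hom-// {x} {y} x∈K y∈K = begin
      f (x // y) + f y  ≈⟨ homo hom (mem-// K x∈K y∈K) y∈K ⟨
      f ((x // y) ∙ y)  ≡⟨ cong f (//-rightDividesˡ y x) ⟩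
      f x               ∎

  module _ (K : DecSubgroup) (x : Carrier) where
    private
      M·x∈K : suc (M ∸ 1) · x ∈ₛ K
      M·x∈K = subst (λ n → n · x ∈ₛ K) (sym (m+[n∸m]≡n {1} {M} (>-nonZero⁻¹ M)))
                (subst (_∈ₛ K) (sym (M-annihilates x)) (mem-ε K))

      minimal : ∃ λ k → suc k · x ∈ₛ K × (∀ {j} → j < k → ¬ (suc j · x ∈ₛ K))
      minimal = least-witness (λ j → T? (mem K (suc j · x))) {M ∸ 1} M·x∈K

    cosetOrder : ℕ
    cosetOrder = suc (proj₁ minimal)

    cosetOrder-· : cosetOrder · x ∈ₛ K
    cosetOrder-· = proj₁ (proj₂ minimal)

    cosetOrder-minimal : ∀ {j} → 0 < j → j < cosetOrder → ¬ (j · x ∈ₛ K)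
    cosetOrder-minimal {suc j} _ (s≤s j<k) = proj₂ (proj₂ minimal) j<k

    cosetOrder-∣ : ∀ {b} → b · x ∈ₛ K → cosetOrder ∣ b
    cosetOrder-∣ {b} b·x∈K with b % cosetOrder in r≡
    ... | zero  = m%n≡0⇒n∣m b cosetOrder r≡
    ... | suc j = contradiction (subst (λ r → r · x ∈ₛ K) r≡ remainder∈K)
                    (cosetOrder-minimal (s≤s z≤n) (subst (_< cosetOrder) r≡ (m%n<n b cosetOrder)))
      where
      q : ℕ
      q = b / cosetOrder
      qd·x∈K : (q * cosetOrder) · x ∈ₛ K
      qd·x∈K = subst (_∈ₛ K) (×-assocˡ x q cosetOrder) (mem-· K q cosetOrder-·)
      remainder∈K : (b % cosetOrder) · x ∈ₛ K
      remainder∈K = subst (_∈ₛ K) (begin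
        b · x // (q * cosetOrder) · x                                  ≡⟨ cong (λ n → n · x // (q * cosetOrder) · x) (m≡m%n+[m/n]*n b cosetOrder) ⟩
        (b % cosetOrder + q * cosetOrder) · x // (q * cosetOrder) · x  ≡⟨ cong (_// (q * cosetOrder) · x) (×-homo-+ x (b % cosetOrder) _) ⟩
        (b % cosetOrder) · x ∙ (q * cosetOrder) · x // (q * cosetOrder) · x ≡⟨ //-rightDividesʳ _ _ ⟩
        (b % cosetOrder) · x                                           ∎)
        (mem-// K b·x∈K qd·x∈K)
        where open ≡-Reasoning

    cosetOrder-∣M : cosetOrder ∣ M
    cosetOrder-∣M = cosetOrder-∣ (subst (_∈ₛ K) (sym (M-annihilates x)) (mem-ε K))

  -- K ∨⟨ x ⟩ is K + ⟨x⟩. Since M · x = ε, v lies in it iff v // a · x ∈ K for some a < M;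
  -- `coefficient v` is the first such a (junk value 0 if there is none).
  module Adjoin (K : DecSubgroup) (x : Carrier) where

    decompose? : ∀ v → Dec (Any (λ a → v // a · x ∈ₛ K) (upTo M))
    decompose? v = any? (λ a → T? (mem K (v // a · x))) (upTo M)

    coefficient : Carrier → ℕ
    coefficient v with decompose? v
    ... | yes p = Any.lookup p
    ... | no  _ = 0

    adjoined : Carrier → Bool
    adjoined v = isYes (decompose? v)

    adjoined-intro : ∀ {v} a → v // a · x ∈ₛ K → T (adjoined v)
    adjoined-intro {v} a p = fromWitness (Any.map (λ { refl → subst (λ y → v // y ∈ₛ K) (sym (·-%M a x)) p })
                                                  (∈-upTo⁺ (m%n<n a M)))

    coefficient-spec : ∀ {v} → T (adjoined v) → v // coefficient v · x ∈ₛ K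
    coefficient-spec {v} p with decompose? v
    ... | yes q = lookup-result q

    subgroup : DecSubgroup
    subgroup = record
      { mem    = adjoined
      ; mem-ε  = adjoined-intro 0 (subst (_∈ₛ K) (sym (//-ε ε)) (mem-ε K))
      ; mem-∙  = λ {v} {w} p q →
          adjoined-intro (coefficient v + coefficient w)
            (subst (_∈ₛ K) (trans (//-∙-interchange v (coefficient v · x) w (coefficient w · x))
                                   (cong ((v ∙ w) //_) (sym (×-homo-+ x (coefficient v) (coefficient w)))))
                   (mem-∙ K (coefficient-spec p) (coefficient-spec q)))
      ; mem-⁻¹ = λ {v} p →
          adjoined-intro ((M ∸ 1) * coefficient v)
            (subst (_∈ₛ K) (trans (sym (⁻¹-∙-comm v _)) (cong (λ y → v ⁻¹ ∙ y ⁻¹) (·-⁻¹ (coefficient v) x)))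
                   (mem-⁻¹ K (coefficient-spec p)))
      }

  infixl 5 _∨⟨_⟩
  _∨⟨_⟩ : DecSubgroup → Carrier → DecSubgroup
  K ∨⟨ x ⟩ = Adjoin.subgroup K x

  module _ (K : DecSubgroup) (x : Carrier) where
    open Adjoin K x using (adjoined-intro)

    ∨-⊇ : ∀ {v} → v ∈ₛ K → v ∈ₛ K ∨⟨ x ⟩
    ∨-⊇ {v} v∈K = adjoined-intro 0 (subst (_∈ₛ K) (sym (//-ε v)) v∈K)

    ∨-· : ∀ a → a · x ∈ₛ K ∨⟨ x ⟩
    ∨-· a = adjoined-intro a (subst (_∈ₛ K) (sym (inverseʳ (a · x))) (mem-ε K))

    ∨-∋ : x ∈ₛ K ∨⟨ x ⟩
    ∨-∋ = subst (_∈ₛ K ∨⟨ x ⟩) (×-homo-1 x) (∨-· 1)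

    ∨-⊆ : ∀ L → (∀ {v} → v ∈ₛ K → v ∈ₛ L) → x ∈ₛ L → ∀ {v} → v ∈ₛ K ∨⟨ x ⟩ → v ∈ₛ L
    ∨-⊆ L K⊆L x∈L {v} p = subst (_∈ₛ L) (//-rightDividesˡ (c · x) v)
                              (mem-∙ L (K⊆L (Adjoin.coefficient-spec K x p)) (mem-· L c x∈L))
      where
      c : ℕ
      c = Adjoin.coefficient K x v

  -- Extends f by k ∙ a · x ↦ f k + a * t; compatibility makes this independent of the decomposition.
  module Extend {K : DecSubgroup} {x : Carrier} {f : Carrier → ℕ} (hom : HomomorphismOn K f)
                (t : ℕ) (compatible : ∀ b → b · x ∈ₛ K → f (b · x) ≈ b * t) where
    open Adjoin K x using (coefficient; coefficient-spec; adjoined-intro)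

    extension : Carrier → ℕ
    extension v = f (v // coefficient v · x) + coefficient v * t

    private
      shift : ∀ {v} a c → v // (a + c) · x ∈ₛ K → v // a · x ∈ₛ K →
              f (v // (a + c) · x) + (a + c) * t ≈ f (v // a · x) + a * t
      shift {v} a c w∈K u∈K = begin
        f w + (a + c) * t       ≡⟨ cong (f w +_) (*-distribʳ-+ t a c) ⟩
        f w + (a * t + c * t)   ≡⟨ ℕ+.x∙yz≈xz∙y (f w) (a * t) (c * t) ⟩
        f w + c * t + a * t     ≈⟨ +-cong (sym f[w∙c·x]) refl ⟩
        f (w ∙ c · x) + a * t   ≡⟨ cong (λ y → f y + a * t) w∙c·x≡u ⟩
        f (v // a · x) + a * t  ∎
        where
        open ≈-Reasoning
        w : Carrier
        w = v // (a + c) · x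
        w∙c·x≡u : w ∙ c · x ≡ v // a · x
        w∙c·x≡u = trans (cong (λ y → (v // y) ∙ c · x) (×-homo-+ x a c)) ([v//pq]q≡v//p v (a · x) (c · x))
        c·x∈K : c · x ∈ₛ K
        c·x∈K = subst (_∈ₛ K) (trans (cong (w \\_) (sym w∙c·x≡u)) (\\-leftDividesʳ w (c · x)))
                      (mem-∙ K (mem-⁻¹ K w∈K) u∈K)
        f[w∙c·x] : f (w ∙ c · x) ≈ f w + c * t
        f[w∙c·x] = trans (homo hom w∈K c·x∈K) (+-cong {f w} refl (compatible c c·x∈K))

      agree : ∀ {v} a b → a ≤ b → v // a · x ∈ₛ K → v // b · x ∈ₛ K →
              f (v // b · x) + b * t ≈ f (v // a · x) + a * t
      agree {v} a b a≤b u∈K w∈K = subst (λ n → f (v // n · x) + n * t ≈ f (v // a · x) + a * t)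
        (m+[n∸m]≡n a≤b) (shift a (b ∸ a) (subst (λ n → v // n · x ∈ₛ K) (sym (m+[n∸m]≡n a≤b)) w∈K) u∈K)

    extension-any : ∀ {v} a → v // a · x ∈ₛ K → extension v ≈ f (v // a · x) + a * t
    extension-any {v} a p with c-spec ← coefficient-spec (adjoined-intro a p) | ≤-total (coefficient v) a
    ... | inj₁ c≤a = sym (agree (coefficient v) a c≤a c-spec p)
    ... | inj₂ a≤c = agree a (coefficient v) a≤c p c-spec

    extension-hom : HomomorphismOn (K ∨⟨ x ⟩) extension
    extension-hom = mkHomomorphismOn extension-homo
      where
      extension-homo : ∀ {v w} → v ∈ₛ K ∨⟨ x ⟩ → w ∈ₛ K ∨⟨ x ⟩ → extension (v ∙ w) ≈ extension v + extension w
      extension-homo {v} {w} p q = begin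
        extension (v ∙ w)                             ≈⟨ extension-any (a + b) vw∈K ⟩
        f ((v ∙ w) // (a + b) · x) + (a + b) * t      ≡⟨ cong₂ _+_ (cong f (sym split)) (*-distribʳ-+ t a b) ⟩
        f ((v // a · x) ∙ (w // b · x)) + (a * t + b * t)
                                                      ≈⟨ +-cong (homo hom (coefficient-spec p) (coefficient-spec q)) refl ⟩
        f (v // a · x) + f (w // b · x) + (a * t + b * t)
                                                      ≡⟨ ℕ+.interchange (f (v // a · x)) _ (a * t) (b * t) ⟩
        extension v + extension w                     ∎
        where
        open ≈-Reasoning
        a : ℕ
        a = coefficient v
        b : ℕ
        b = coefficient w
        split : (v // a · x) ∙ (w // b · x) ≡ (v ∙ w) // (a + b) · x
        split = trans (//-∙-interchange v (a · x) w (b · x)) (cong ((v ∙ w) //_) (sym (×-homo-+ x a b)))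
        vw∈K : (v ∙ w) // (a + b) · x ∈ₛ K
        vw∈K = subst (_∈ₛ K) split (mem-∙ K (coefficient-spec p) (coefficient-spec q))

    extension-extends : ∀ {v} → v ∈ₛ K → extension v ≈ f v
    extension-extends {v} v∈K = trans (extension-any 0 (subst (_∈ₛ K) (sym (//-ε v)) v∈K))
                                      (cong (_% M) (trans (+-identityʳ _) (cong f (//-ε v))))

    extension-· : ∀ a → extension (a · x) ≈ a * t
    extension-· a = trans (extension-any a (subst (_∈ₛ K) (sym (inverseʳ (a · x))) (mem-ε K)))
                          (+-cong (trans (cong (λ y → f y % M) (inverseʳ (a · x))) (hom-ε hom)) refl)

  -- With d the order of x modulo K, (M / d) * f (d · x) ≈ f (M · x) ≈ 0 forces f (d · x) = k * d; take t = k.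
  compatible-exists : ∀ {K f} → HomomorphismOn K f → ∀ x → ∃ λ t → ∀ b → b · x ∈ₛ K → f (b · x) ≈ b * t
  compatible-exists {K} {f} hom x = k , compatible
    where
    d : ℕ
    d = cosetOrder K x
    q : ℕ
    q = M / d
    M≡q*d : M ≡ q * d
    M≡q*d = sym (m/n*n≡m (cosetOrder-∣M K x))
    instance
      q≢0 : NonZero q
      q≢0 = m*n≢0⇒m≢0 q {{subst NonZero M≡q*d M≢0}}
    F : ℕ
    F = f (d · x)
    q*F≈0 : q * F ≈ 0
    q*F≈0 = begin
      q * F             ≈⟨ hom-· hom (cosetOrder-· K x) q ⟨
      f (q · d · x)     ≡⟨ cong f (trans (×-assocˡ x q d) (cong (_· x) (sym M≡q*d))) ⟩
      f (M · x)         ≡⟨ cong f (M-annihilates x) ⟩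
      f ε               ≈⟨ hom-ε hom ⟩
      0                 ∎
      where open ≈-Reasoning
    k : ℕ
    k = _∣_.quotient (≈0⇒∣ q*F≈0)
    F≡k*d : F ≡ k * d
    F≡k*d = *-cancelˡ-≡ F (k * d) q (begin
      q * F          ≡⟨ _∣_.equality (≈0⇒∣ q*F≈0) ⟩
      k * M          ≡⟨ cong (k *_) M≡q*d ⟩
      k * (q * d)    ≡⟨ ℕ*.x∙yz≈y∙xz k q d ⟩
      q * (k * d)    ∎)
      where open ≡-Reasoning
    compatible : ∀ b → b · x ∈ₛ K → f (b · x) ≈ b * k
    compatible b b·x∈K with divides c refl ← cosetOrder-∣ K x {b} b·x∈K = begin
      f ((c * d) · x)   ≡⟨ cong f (×-assocˡ x c d) ⟨
      f (c · d · x)     ≈⟨ hom-· hom (cosetOrder-· K x) c ⟩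
      c * F             ≡⟨ cong (c *_) F≡k*d ⟩
      c * (k * d)       ≡⟨ ℕ*.x∙yz≈xz∙y c k d ⟩
      c * d * k         ∎
      where open ≈-Reasoning

  adjoinAll : DecSubgroup → List Carrier → DecSubgroup
  adjoinAll K []       = K
  adjoinAll K (x ∷ xs) = adjoinAll (K ∨⟨ x ⟩) xs

  adjoinAll-⊇ : ∀ K xs {v} → v ∈ₛ K → v ∈ₛ adjoinAll K xs
  adjoinAll-⊇ K []       v∈K = v∈K
  adjoinAll-⊇ K (x ∷ xs) v∈K = adjoinAll-⊇ (K ∨⟨ x ⟩) xs (∨-⊇ K x v∈K)

  adjoinAll-∋ : ∀ K xs {v} → v ∈ xs → v ∈ₛ adjoinAll K xs
  adjoinAll-∋ K (x ∷ xs) (here refl) = adjoinAll-⊇ (K ∨⟨ x ⟩) xs (∨-∋ K x)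
  adjoinAll-∋ K (x ∷ xs) (there v∈)  = adjoinAll-∋ (K ∨⟨ x ⟩) xs v∈

  adjoinAll-⊆ : ∀ K xs L → (∀ {v} → v ∈ₛ K → v ∈ₛ L) → (∀ {v} → v ∈ xs → v ∈ₛ L) →
                ∀ {v} → v ∈ₛ adjoinAll K xs → v ∈ₛ L
  adjoinAll-⊆ K []       L K⊆L xs⊆L = K⊆L
  adjoinAll-⊆ K (x ∷ xs) L K⊆L xs⊆L = adjoinAll-⊆ (K ∨⟨ x ⟩) xs L (∨-⊆ K x L K⊆L (xs⊆L (here refl))) (xs⊆L ∘ there)

  extendAlong : ∀ xs {K f} → HomomorphismOn K f →
                ∃ λ g → HomomorphismOn (adjoinAll K xs) g × (∀ {v} → v ∈ₛ K → g v ≈ f v)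
  extendAlong []           {f = f} hom = f , hom , λ _ → refl
  extendAlong (x ∷ xs) {K} hom with t , compatible ← compatible-exists hom x =
    let open Extend hom t compatible
        g , g-hom , g≈ = extendAlong xs extension-hom
    in g , g-hom , λ {v} v∈K → trans (g≈ (∨-⊇ K x v∈K)) (extension-extends v∈K)

  extendToCharacter : ∀ {K f} → HomomorphismOn K f → ∃ λ χ → IsCharacter χ × (∀ {v} → v ∈ₛ K → χ v ≈ f v)
  extendToCharacter {K} hom with χ , χ-hom , χ≈ ← extendAlong elements hom =
    χ , mkHomomorphismOn (λ {x} {y} _ _ → homo χ-hom (adjoinAll-∋ K elements (∈-elements x)) (adjoinAll-∋ K elements (∈-elements y))) , χ≈

  module Vanishing (K : DecSubgroup) (x : Carrier) where
    private
      d : ℕ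
      d = cosetOrder K x

      vanishes : ∀ b → b · x ∈ₛ K → 0 ≈ b * (M / d)
      vanishes b b·x∈K with divides c refl ← cosetOrder-∣ K x {b} b·x∈K =
        sym (subst (_≈ 0) (sym c*d*[M/d]≡c*M) (multiple≈0 c))
        where
        c*d*[M/d]≡c*M : c * d * (M / d) ≡ c * M
        c*d*[M/d]≡c*M = trans (*-assoc c d (M / d))
                          (cong (c *_) (trans (*-comm d (M / d)) (m/n*n≡m (cosetOrder-∣M K x))))

    open Extend {K} {x} {λ _ → 0} (mkHomomorphismOn λ _ _ → refl) (M / d) vanishes public

  order : Carrier → ℕ
  order = cosetOrder trivial

  opaque
    faithfulCharacter : ∀ g → ∃ λ χ → IsCharacter χ × (∀ a → χ (a · g) ≈ a * (M / order g))
    faithfulCharacter g with χ , χ-character , χ≈ ← extendToCharacter (Vanishing.extension-hom trivial g) =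
      χ , χ-character , λ a → trans (χ≈ (∨-· trivial g a)) (Vanishing.extension-· trivial g a)

  residue : (Carrier → ℕ) → Carrier → ℕ
  residue ρ v = ρ v % M

  card-by-residues : ∀ {K ρ} → HomomorphismOn K ρ →
                     card (mem K) ≡ card (kernelIn _≟ℕ_ K (residue ρ)) * length (image _≟ℕ_ (residue ρ) (members (mem K)))
  card-by-residues {K} {ρ} hom = card≡card-kernel*image _≟ℕ_ K (residue ρ) λ v∈K w∈K → mk⇔ (to v∈K w∈K) (from v∈K w∈K)
    where
    open ≈-Reasoning
    to : ∀ {v w} → v ∈ₛ K → w ∈ₛ K → ρ v ≈ ρ w → ρ (v \\ w) ≈ ρ ε
    to {v} {w} v∈K w∈K ρv≈ρw = begin
      ρ (v ⁻¹ ∙ w)      ≈⟨ homo hom (mem-⁻¹ K v∈K) w∈K ⟩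
      ρ (v ⁻¹) + ρ w    ≈⟨ +-cong {ρ (v ⁻¹)} refl (sym ρv≈ρw) ⟩
      ρ (v ⁻¹) + ρ v    ≈⟨ hom-⁻¹ hom v∈K ⟩
      0                 ≈⟨ hom-ε hom ⟨
      ρ ε               ∎
    from : ∀ {v w} → v ∈ₛ K → w ∈ₛ K → ρ (v \\ w) ≈ ρ ε → ρ v ≈ ρ w
    from {v} {w} v∈K w∈K ρ[v\\w]≈ρε = begin
      ρ v                 ≡⟨ +-identityʳ (ρ v) ⟨
      ρ v + 0             ≈⟨ +-cong {ρ v} refl (trans ρ[v\\w]≈ρε (hom-ε hom)) ⟨
      ρ v + ρ (v \\ w)    ≈⟨ homo hom v∈K (mem-∙ K (mem-⁻¹ K v∈K) w∈K) ⟨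
      ρ (v ∙ (v \\ w))    ≡⟨ cong ρ (\\-leftDividesˡ v w) ⟩
      ρ w                 ∎

  card-∨ : ∀ K x → cosetOrder K x * card (mem K) ≤ card (mem (K ∨⟨ x ⟩))
  card-∨ K x = begin
    d * card (mem K)            ≤⟨ *-mono-≤ d≤|image| K≤kernel ⟩
    length img * card kernel    ≡⟨ *-comm (length img) (card kernel) ⟩
    card kernel * length img    ≡⟨ card-by-residues extension-hom ⟨
    card (mem (K ∨⟨ x ⟩))       ∎
    where
    open ≤-Reasoning
    open Vanishing K x
    open Divisor (cosetOrder-∣M K x)
    d : ℕ
    d = cosetOrder K x
    kernel : Carrier → Bool
    kernel = kernelIn _≟ℕ_ (K ∨⟨ x ⟩) (residue extension)
    img : List ℕ
    img = image _≟ℕ_ (residue extension) (members (mem (K ∨⟨ x ⟩)))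
    K≤kernel : card (mem K) ≤ card kernel
    K≤kernel = card-mono λ {v} v∈K → Equivalence.from T-∧
      (∨-⊇ K x v∈K , fromWitness (trans (extension-extends v∈K) (sym (extension-extends (mem-ε K)))))
    d≤|image| : d ≤ length img
    d≤|image| = subst (_≤ length img) length-multiples (Unique-⊆⇒length≤ multiples-Unique multiples⊆img)
      where
      multiples⊆img : ∀ {c} → c ∈ multiples (M / d) d → c ∈ img
      multiples⊆img c∈ with a , a<d , refl ← ∈-multiples⁻ c∈ =
        subst (_∈ img) (trans (extension-· a) (m<n⇒m%n≡m (multiple<M a<d)))
              (∈-image⁺ _≟ℕ_ (∈-members⁺ (mem (K ∨⟨ x ⟩)) (∨-· K x a)))

module Duality (G : EnumeratedGroup) (comm : IsCommutativeGroup G)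
               (M : ℕ) .{{M≢0 : NonZero M}} (M-annihilates : AnnihilatedBy G M)
               (P : Characters.Pairing G comm M M-annihilates) where

  open EnumeratedGroup G
  open import Data.Bool using (Bool; T)
  open import Data.Bool.Properties using (T-∧)
  open import Data.Nat using (ℕ; _*_; _≤_; _/_; _%_; NonZero)
  open import Data.Nat.Properties
    using (≤-refl; ≤-trans; ≤-reflexive; ≤-antisym; *-identityˡ; *-identityʳ; *-mono-≤; *-monoˡ-≤; *-monoʳ-≤;
           +-identityˡ; *-commutativeSemigroup; module ≤-Reasoning)
    renaming (_≟_ to _≟ℕ_)
  open import Data.Nat.DivMod using (m%n<n)
  open import Data.List using (List; []; _∷_; length)
  open import Data.List.Membership.Propositional using (_∈_)
  open import Data.List.Relation.Unary.All as All using (all?)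
  open import Data.Product using (_,_)
  import Algebra.Properties.CommutativeSemigroup *-commutativeSemigroup as ℕ*
  open import Function using (Equivalence)
  open import Relation.Nullary using (yes; no)
  open import Relation.Nullary.Decidable using (T?; isYes; toWitness; fromWitness; _→-dec_)
  open import Relation.Binary.PropositionalEquality
  open Counting
  open EnumeratedGroups
  open ModularArithmetic

  open Subgroups G
  open Modulo M
  open Characters G comm M M-annihilates
  open Pairing P

  pairingˡ-hom : ∀ y → HomomorphismOn full (λ x → ⟨ x , y ⟩)
  pairingˡ-hom y = mkHomomorphismOn λ {x} {x′} _ _ → linearˡ x x′ y

  pairingʳ-hom : ∀ x → HomomorphismOn full ⟨ x ,_⟩
  pairingʳ-hom x = mkHomomorphismOn λ {y} {y′} _ _ → linearʳ x y y′

  orthogonalTo : Carrier → DecSubgroup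
  orthogonalTo y = record
    { mem    = λ x → isYes (⟨ x , y ⟩ ≈? 0)
    ; mem-ε  = fromWitness (hom-ε (pairingˡ-hom y))
    ; mem-∙  = λ {x} {x′} p q → fromWitness (trans (linearˡ x x′ y) (+-cong (toWitness p) (toWitness q)))
    ; mem-⁻¹ = λ {x} p → fromWitness (+-cancelʳ ⟨ x , y ⟩ (trans (hom-⁻¹ (pairingˡ-hom y) _)
                                                               (sym (trans (cong (_% M) (+-identityˡ _)) (toWitness p)))))
    }

  module _ (K : DecSubgroup) where

    orthogonal : Carrier → Bool
    orthogonal y = isYes (all? (λ x → T? (mem K x) →-dec (⟨ x , y ⟩ ≈? 0)) elements)

    orthogonal-intro : ∀ {y} → (∀ {x} → x ∈ₛ K → ⟨ x , y ⟩ ≈ 0) → T (orthogonal y)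
    orthogonal-intro ⊥y = fromWitness (All.tabulate λ _ → ⊥y)

    orthogonal-elim : ∀ {y} → T (orthogonal y) → ∀ {x} → x ∈ₛ K → ⟨ x , y ⟩ ≈ 0
    orthogonal-elim ⊥y {x} = All.lookup (toWitness ⊥y) (∈-elements x)

  infix 10 _ᗮ
  _ᗮ : DecSubgroup → DecSubgroup
  K ᗮ = record
    { mem    = orthogonal K
    ; mem-ε  = orthogonal-intro K λ {x} _ → hom-ε (pairingʳ-hom x)
    ; mem-∙  = λ {y} {y′} p q → orthogonal-intro K λ {x} x∈K →
                 trans (linearʳ x y y′) (+-cong (orthogonal-elim K p x∈K) (orthogonal-elim K q x∈K))
    ; mem-⁻¹ = λ {y} p → orthogonal-intro K λ {x} x∈K →
                 +-cancelʳ ⟨ x , y ⟩ (trans (hom-⁻¹ (pairingʳ-hom x) _)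
                                            (sym (trans (cong (_% M) (+-identityˡ _)) (orthogonal-elim K p x∈K))))
    }

  ᗮ-antitone : ∀ K L → (∀ {v} → v ∈ₛ K → v ∈ₛ L) → ∀ {y} → y ∈ₛ L ᗮ → y ∈ₛ K ᗮ
  ᗮ-antitone K L K⊆L y∈Lᗮ = orthogonal-intro K λ x∈K → orthogonal-elim L y∈Lᗮ (K⊆L x∈K)

  cosetOrder*residue≈0 : ∀ K x {y} → y ∈ₛ K ᗮ → cosetOrder K x * (⟨ x , y ⟩ % M) ≈ 0
  cosetOrder*residue≈0 K x {y} y∈Kᗮ = begin
    d * (⟨ x , y ⟩ % M)   ≈⟨ *-congˡ d (%-≈ ⟨ x , y ⟩) ⟩
    d * ⟨ x , y ⟩         ≈⟨ hom-· (pairingˡ-hom y) {x} _ d ⟨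
    ⟨ d · x , y ⟩         ≈⟨ orthogonal-elim K y∈Kᗮ (cosetOrder-· K x) ⟩
    0                     ∎
    where
    open ≈-Reasoning
    d : ℕ
    d = cosetOrder K x

  card-ᗮ-∨ : ∀ K x → card (mem (K ᗮ)) ≤ card (mem ((K ∨⟨ x ⟩) ᗮ)) * cosetOrder K x
  card-ᗮ-∨ K x = begin
    card (mem (K ᗮ))                 ≡⟨ card-by-residues pairWithX ⟩
    card kernel * length img         ≤⟨ *-mono-≤ kernel≤ img≤d ⟩
    card (mem ((K ∨⟨ x ⟩) ᗮ)) * d    ∎
    where
    open ≤-Reasoning
    open Divisor (cosetOrder-∣M K x)
    d : ℕ
    d = cosetOrder K x
    pairWithX : HomomorphismOn (K ᗮ) ⟨ x ,_⟩
    pairWithX = mkHomomorphismOn λ {y} {y′} _ _ → linearʳ x y y′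
    kernel : Carrier → Bool
    kernel = kernelIn _≟ℕ_ (K ᗮ) (residue ⟨ x ,_⟩)
    img : List ℕ
    img = image _≟ℕ_ (residue ⟨ x ,_⟩) (members (mem (K ᗮ)))
    kernel≤ : card kernel ≤ card (mem ((K ∨⟨ x ⟩) ᗮ))
    kernel≤ = card-mono λ {y} p →
      let y∈Kᗮ , ⟨x,y⟩≈⟨x,ε⟩ = Equivalence.to T-∧ p
          x⊥y : x ∈ₛ orthogonalTo y
          x⊥y = fromWitness (trans (toWitness ⟨x,y⟩≈⟨x,ε⟩) (hom-ε pairWithX))
      in orthogonal-intro (K ∨⟨ x ⟩) λ v∈ →
           toWitness (∨-⊆ K x (orthogonalTo y) (λ v∈K → fromWitness (orthogonal-elim K y∈Kᗮ v∈K)) x⊥y v∈)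
    img≤d : length img ≤ d
    img≤d = ≤-trans (length-image≤ _≟ℕ_ img⊆multiples) (≤-reflexive length-multiples)
      where
      img⊆multiples : ∀ {c} → c ∈ img → c ∈ multiples (M / d) d
      img⊆multiples c∈ with y , y∈ , refl ← ∈-image⁻ _≟ℕ_ c∈ =
        annihilated⇒multiple (m%n<n ⟨ x , y ⟩ M) (cosetOrder*residue≈0 K x (∈-members⁻ (mem (K ᗮ)) y∈))

  cardProduct : DecSubgroup → ℕ
  cardProduct K = card (mem K) * card (mem (K ᗮ))

  cardProduct-cong : ∀ K L → (∀ {v} → v ∈ₛ K → v ∈ₛ L) → (∀ {v} → v ∈ₛ L → v ∈ₛ K) →
                     cardProduct K ≡ cardProduct L
  cardProduct-cong K L K⊆L L⊆K = cong₂ _*_ (card-cong K⊆L L⊆K) (card-cong (ᗮ-antitone L K L⊆K) (ᗮ-antitone K L K⊆L))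

  cardProduct-∨ : ∀ K x → cardProduct K ≤ cardProduct (K ∨⟨ x ⟩)
  cardProduct-∨ K x = begin
    card (mem K) * card (mem (K ᗮ))                 ≤⟨ *-monoʳ-≤ (card (mem K)) (card-ᗮ-∨ K x) ⟩
    card (mem K) * (card (mem ((K ∨⟨ x ⟩) ᗮ)) * d)    ≡⟨ ℕ*.x∙yz≈zx∙y (card (mem K)) _ d ⟩
    d * card (mem K) * card (mem ((K ∨⟨ x ⟩) ᗮ))      ≤⟨ *-monoˡ-≤ _ (card-∨ K x) ⟩
    cardProduct (K ∨⟨ x ⟩)                          ∎
    where
    open ≤-Reasoning
    d : ℕ
    d = cosetOrder K x

  cardProduct-adjoinAll : ∀ K xs → cardProduct K ≤ cardProduct (adjoinAll K xs)
  cardProduct-adjoinAll K []       = ≤-refl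
  cardProduct-adjoinAll K (x ∷ xs) = ≤-trans (cardProduct-∨ K x) (cardProduct-adjoinAll (K ∨⟨ x ⟩) xs)

  cardProduct-trivial : cardProduct trivial ≡ card (mem full)
  cardProduct-trivial = begin
    card (mem trivial) * card (mem (trivial ᗮ))   ≡⟨ cong (_* card (mem (trivial ᗮ))) card-trivial ⟩
    1 * card (mem (trivial ᗮ))                    ≡⟨ *-identityˡ _ ⟩
    card (mem (trivial ᗮ))                        ≡⟨ card-cong _ everything⊥trivial ⟩
    card (mem full)                               ∎
    where
    open ≡-Reasoning
    everything⊥trivial : ∀ {y} → y ∈ₛ full → y ∈ₛ trivial ᗮ
    everything⊥trivial {y} _ = orthogonal-intro trivial λ x≡ε →
      subst (λ x → ⟨ x , y ⟩ ≈ 0) (sym (toWitness x≡ε)) (hom-ε (pairingˡ-hom y))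

  cardProduct-full : cardProduct full ≡ card (mem full)
  cardProduct-full = begin
    card (mem full) * card (mem (full ᗮ))   ≡⟨ cong (card (mem full) *_) (trans (card-cong fullᗮ⊆trivial trivial⊆fullᗮ) card-trivial) ⟩
    card (mem full) * 1                     ≡⟨ *-identityʳ _ ⟩
    card (mem full)                         ∎
    where
    open ≡-Reasoning
    fullᗮ⊆trivial : ∀ {y} → y ∈ₛ full ᗮ → y ∈ₛ trivial
    fullᗮ⊆trivial {y} y∈fullᗮ with y ≟ ε
    ... | yes y≡ε = _
    ... | no  y≢ε = let x , ⟨x,y⟩≉0 = nondegenerateʳ y≢ε in ⟨x,y⟩≉0 (orthogonal-elim full y∈fullᗮ _)
    trivial⊆fullᗮ : ∀ {y} → y ∈ₛ trivial → y ∈ₛ full ᗮ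
    trivial⊆fullᗮ {y} y≡ε = subst (_∈ₛ full ᗮ) (sym (toWitness y≡ε)) (mem-ε (full ᗮ))

  -- cardProduct never decreases when a generator is adjoined and equals |G| at both ends, so
  -- adjoining all of G to K, and the elements of K to the trivial subgroup, squeezes it to |G|.
  duality : ∀ K → card (mem K) * card (mem (K ᗮ)) ≡ card (mem full)
  duality K = ≤-antisym
    (begin
      cardProduct K                          ≤⟨ cardProduct-adjoinAll K elements ⟩
      cardProduct (adjoinAll K elements)     ≡⟨ cardProduct-cong (adjoinAll K elements) full _ (λ {v} _ → adjoinAll-∋ K elements (∈-elements v)) ⟩
      cardProduct full                       ≡⟨ cardProduct-full ⟩
      card (mem full)                        ∎)
    (begin
      card (mem full)                        ≡⟨ cardProduct-trivial ⟨
      cardProduct trivial                    ≤⟨ cardProduct-adjoinAll trivial (members (mem K)) ⟩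
      cardProduct (adjoinAll trivial (members (mem K)))
                                             ≡⟨ cardProduct-cong (adjoinAll trivial (members (mem K))) K generated⊆K K⊆generated ⟩
      cardProduct K                          ∎)
    where
    open ≤-Reasoning
    generated⊆K : ∀ {v} → v ∈ₛ adjoinAll trivial (members (mem K)) → v ∈ₛ K
    generated⊆K = adjoinAll-⊆ trivial (members (mem K)) K
      (λ v≡ε → subst (_∈ₛ K) (sym (toWitness v≡ε)) (mem-ε K)) (∈-members⁻ (mem K))
    K⊆generated : ∀ {v} → v ∈ₛ K → v ∈ₛ adjoinAll trivial (members (mem K))
    K⊆generated v∈K = adjoinAll-∋ trivial (members (mem K)) (∈-members⁺ (mem K) v∈K)

module SelfDual (G : EnumeratedGroup) (comm : IsCommutativeGroup G)
                (M : ℕ) .{{M≢0 : NonZero M}} (M-annihilates : AnnihilatedBy G M) where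

  open EnumeratedGroup G
  open import Algebra.Bundles using (AbelianGroup)
  open import Data.Bool using (Bool; T; _∧_)
  open import Data.Bool.Properties using (T-∧)
  open import Data.Nat using (ℕ; zero; suc; _+_; _*_; _≤_; _<_; z≤n; s≤s; _%_; _/_; NonZero; >-nonZero; _≤?_)
  open import Data.Nat.Properties renaming (_≟_ to _≟ℕ_)
  import Algebra.Properties.CommutativeSemigroup +-commutativeSemigroup as ℕ+
  import Algebra.Properties.CommutativeSemigroup *-commutativeSemigroup as ℕ*
  open import Data.Nat.DivMod using (m≡m%n+[m/n]*n; m%n<n; m/n*n≡m; m<n⇒m%n≡m; n/n≡1; 0/n≡0)
  open import Data.Nat.Divisibility using (_∣_; ∣⇒≤; *-cancelʳ-∣; m%n≡0⇒n∣m)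
  open import Data.List using (List; []; _∷_; length)
  open import Data.List.Extrema.Nat using (argmax; argmin; argmax-all; argmin-all; f[xs]≤f[argmax]; f[argmin]≤f[xs])
  open import Data.List.Membership.Propositional using (_∈_; find; lose)
  open import Data.List.Membership.Propositional.Properties using (∈-length)
  open import Data.List.Relation.Unary.Any using (any?)
  import Data.List.Relation.Unary.All as All
  open import Data.List.Relation.Unary.Any using (here)
  open import Data.Product using (∃; _×_; _,_; proj₁; proj₂)
  open import Function using (_∘_; Equivalence)
  open import Relation.Nullary using (¬_; yes; no; contradiction)
  open import Relation.Nullary.Decidable using (T?; isYes; toWitness; fromWitness; _×-dec_; ¬?; decidable-stable)
  open import Relation.Binary.PropositionalEquality
  open Counting
  open EnumeratedGroups
  open ModularArithmetic

  open Subgroups G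
  open Modulo M
  open Characters G comm M M-annihilates
  open import Algebra.Properties.CommutativeMonoid.Mult (AbelianGroup.commutativeMonoid abelianGroup)
    using (×-homo-+; ×-assocˡ; ×-homo-1)

  record PairingOn (C : DecSubgroup) : Set where
    field
      ⟨_,_⟩          : Carrier → Carrier → ℕ
      linearˡ        : ∀ {x x′ y} → x ∈ₛ C → x′ ∈ₛ C → y ∈ₛ C → ⟨ x ∙ x′ , y ⟩ ≈ ⟨ x , y ⟩ + ⟨ x′ , y ⟩
      linearʳ        : ∀ {x y y′} → x ∈ₛ C → y ∈ₛ C → y′ ∈ₛ C → ⟨ x , y ∙ y′ ⟩ ≈ ⟨ x , y ⟩ + ⟨ x , y′ ⟩
      nondegenerateʳ : ∀ {y} → y ∈ₛ C → y ≢ ε → ∃ λ x → x ∈ₛ C × ¬ (⟨ x , y ⟩ ≈ 0)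

  values : DecSubgroup → (Carrier → ℕ) → List ℕ
  values C χ = image _≟ℕ_ (residue χ) (members (mem C))

  order≤values : ∀ C {g} → g ∈ₛ C → order g ≤ length (values C (proj₁ (faithfulCharacter g)))
  order≤values C {g} g∈C =
    subst (_≤ length (values C ψ)) length-multiples (Unique-⊆⇒length≤ multiples-Unique multiples⊆values)
    where
    open Divisor (cosetOrder-∣M trivial g)
    ψ : Carrier → ℕ
    ψ = proj₁ (faithfulCharacter g)
    ψ[a·g]≈ : ∀ a → ψ (a · g) ≈ a * (M / order g)
    ψ[a·g]≈ = proj₂ (proj₂ (faithfulCharacter g))
    multiples⊆values : ∀ {c} → c ∈ multiples (M / order g) (order g) → c ∈ values C ψ
    multiples⊆values c∈ with a , a<o , refl ← ∈-multiples⁻ c∈ =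
      subst (_∈ values C ψ) (trans (ψ[a·g]≈ a) (m<n⇒m%n≡m (multiple<M a<o)))
            (∈-image⁺ _≟ℕ_ (∈-members⁺ (mem C) (mem-· C a g∈C)))

  opaque
    largeCharacter : ∀ C → ∃ λ χ → IsCharacter χ × (∀ {g} → g ∈ₛ C → order g ≤ length (values C χ))
    largeCharacter C = ψ best , ψ-character best , λ {g} g∈C →
      ≤-trans (order≤values C g∈C) (All.lookup (f[xs]≤f[argmax] {f = size} ε elements) (∈-elements g))
      where
      ψ : Carrier → Carrier → ℕ
      ψ h = proj₁ (faithfulCharacter h)
      ψ-character : ∀ h → IsCharacter (ψ h)
      ψ-character h = proj₁ (proj₂ (faithfulCharacter h))
      size : Carrier → ℕ
      size h = length (values C (ψ h))
      best : Carrier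
      best = argmax size ε elements

  module _ (C : DecSubgroup) {χ : Carrier → ℕ} (χ-character : IsCharacter χ) where

    private
      inKernel : Carrier → Bool
      inKernel x = mem C x ∧ isYes (χ x ≈? 0)

    ∈-characterKernel⁺ : ∀ {x} → x ∈ₛ C → χ x ≈ 0 → T (inKernel x)
    ∈-characterKernel⁺ x∈C χx≈0 = Equivalence.from T-∧ (x∈C , fromWitness χx≈0)

    ∈-characterKernel⁻ : ∀ {x} → T (inKernel x) → x ∈ₛ C × χ x ≈ 0
    ∈-characterKernel⁻ {x} p = let x∈C , χx≈0 = Equivalence.to (T-∧ {mem C x}) p in x∈C , toWitness χx≈0

    characterKernel : DecSubgroup
    characterKernel = record
      { mem    = inKernel
      ; mem-ε  = ∈-characterKernel⁺ (mem-ε C) (hom-ε χ-character)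
      ; mem-∙  = λ {x} {y} p q →
          let x∈C , χx≈0 = ∈-characterKernel⁻ p
              y∈C , χy≈0 = ∈-characterKernel⁻ q
          in ∈-characterKernel⁺ (mem-∙ C x∈C y∈C) (trans (homo χ-character {x} {y} _ _) (+-cong χx≈0 χy≈0))
      ; mem-⁻¹ = λ {x} p →
          let x∈C , χx≈0 = ∈-characterKernel⁻ p
          in ∈-characterKernel⁺ (mem-⁻¹ C x∈C)
               (+-cancelʳ (χ x) (trans (hom-⁻¹ χ-character {x} _) (sym (trans (cong (_% M) (+-identityˡ (χ x))) χx≈0))))
      }

  -- The values of χ on C are the multiples of the least positive one, s = residue χ g, so there are
  -- M / s of them; the order of g is at most that many (order≤) and divisible by M / s. Hence
  -- C = ⟨g⟩ × (C ∩ ker χ) via x = π x ∙ u x · g, and a pairing on C ∩ ker χ extends to C by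
  -- ⟨ x , y ⟩ = u x * χ y + ⟨ π x , π y ⟩.
  module Split (C : DecSubgroup) {χ : Carrier → ℕ} (χ-character : IsCharacter χ)
               (order≤ : ∀ {x} → x ∈ₛ C → order x ≤ length (values C χ))
               {g : Carrier} (g∈C : g ∈ₛ C) (s-positive : 0 < residue χ g)
               (s-minimal : ∀ {x} → x ∈ₛ C → 0 < residue χ x → residue χ g ≤ residue χ x) where

    s : ℕ
    s = residue χ g

    instance
      s≢0 : NonZero s
      s≢0 = >-nonZero s-positive

    χ≈residue : ∀ x → χ x ≈ residue χ x
    χ≈residue x = sym (%-≈ (χ x))

    residue-// : ∀ {x c} → χ x ≈ c → residue χ (x // (c / s) · g) ≡ c % s
    residue-// {x} {c} χx≈c = trans (+-cancelʳ (c / s * s) (begin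
      χ (x // q · g) + q * s          ≈⟨ +-cong {χ (x // q · g)} refl (*-congˡ q (χ≈residue g)) ⟨
      χ (x // q · g) + q * χ g        ≈⟨ +-cong {χ (x // q · g)} refl (hom-· χ-character {g} _ q) ⟨
      χ (x // q · g) + χ (q · g)      ≈⟨ hom-// χ-character {x} {q · g} _ _ ⟩
      χ x                             ≈⟨ χx≈c ⟩
      c                               ≡⟨ m≡m%n+[m/n]*n c s ⟩
      c % s + q * s                   ∎))
      (m<n⇒m%n≡m (<-trans (m%n<n c s) (m%n<n (χ g) M)))
      where
      open ≈-Reasoning
      q : ℕ
      q = c / s

    s-divides : ∀ {x c} → x ∈ₛ C → χ x ≈ c → s ∣ c
    s-divides {x} {c} x∈C χx≈c with c % s in r≡
    ... | zero  = m%n≡0⇒n∣m c s r≡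
    ... | suc j = contradiction (s-minimal (mem-// C x∈C (mem-· C (c / s) g∈C)) (subst (0 <_) (sym remainder) (s≤s z≤n)))
                                (<⇒≱ (subst (_< s) (sym remainder) (subst (_< s) r≡ (m%n<n c s))))
      where
      remainder : residue χ (x // (c / s) · g) ≡ suc j
      remainder = trans (residue-// χx≈c) r≡

    s∣M : s ∣ M
    s∣M = s-divides (mem-ε C) (trans (hom-ε χ-character) (sym M≈0))

    open Divisor s∣M

    e : ℕ
    e = M / s

    u : Carrier → ℕ
    u x = residue χ x / s

    residue≡u*s : ∀ {x} → x ∈ₛ C → residue χ x ≡ u x * s
    residue≡u*s {x} x∈C = sym (m/n*n≡m (s-divides x∈C (χ≈residue x)))

    χ≈u*s : ∀ {x} → x ∈ₛ C → χ x ≈ u x * s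
    χ≈u*s {x} x∈C = trans (χ≈residue x) (cong (_% M) (residue≡u*s x∈C))

    u<e : ∀ {x} → x ∈ₛ C → u x < e
    u<e {x} x∈C = *-cancelʳ-< s (u x) e (subst₂ _<_ (residue≡u*s x∈C) M≡[M/d]*d (m%n<n (χ x) M))

    |values|≤e : length (values C χ) ≤ e
    |values|≤e = ≤-trans (length-image≤ _≟ℕ_ values⊆multiples) (≤-reflexive length-multiples)
      where
      values⊆multiples : ∀ {c} → c ∈ values C χ → c ∈ multiples s e
      values⊆multiples c∈ with x , x∈ , refl ← ∈-image⁻ _≟ℕ_ c∈ =
        let x∈C = ∈-members⁻ (mem C) x∈ in subst (_∈ multiples s e) (sym (residue≡u*s x∈C)) (∈-multiples⁺ (u<e x∈C))

    e∣order : e ∣ order g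
    e∣order = *-cancelʳ-∣ s (subst (_∣ order g * s) M≡[M/d]*d (≈0⇒∣ (begin
      order g * s           ≈⟨ *-congˡ (order g) (χ≈residue g) ⟨
      order g * χ g         ≈⟨ hom-· χ-character {g} _ (order g) ⟨
      χ (order g · g)       ≡⟨ cong χ (toWitness (cosetOrder-· trivial g)) ⟩
      χ ε                   ≈⟨ hom-ε χ-character ⟩
      0                     ∎)))
      where open ≈-Reasoning

    order≡e : order g ≡ e
    order≡e = ≤-antisym (≤-trans (order≤ g∈C) |values|≤e) (∣⇒≤ e∣order)

    e·g≡ε : e · g ≡ ε
    e·g≡ε = subst (λ n → n · g ≡ ε) order≡e (toWitness (cosetOrder-· trivial g))

    ·g-mod-e : ∀ a → a · g ≡ (a % e) · g
    ·g-mod-e a = begin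
      a · g                                 ≡⟨ cong (_· g) (m≡m%n+[m/n]*n a e) ⟩
      (a % e + a / e * e) · g               ≡⟨ ×-homo-+ g (a % e) (a / e * e) ⟩
      (a % e) · g ∙ (a / e * e) · g         ≡⟨ cong ((a % e) · g ∙_) (×-assocˡ g (a / e) e) ⟨
      (a % e) · g ∙ (a / e) · e · g         ≡⟨ cong (λ y → (a % e) · g ∙ (a / e) · y) e·g≡ε ⟩
      (a % e) · g ∙ (a / e) · ε             ≡⟨ cong ((a % e) · g ∙_) (·-ε (a / e)) ⟩
      (a % e) · g ∙ ε                       ≡⟨ identityʳ _ ⟩
      (a % e) · g                           ∎
      where open ≡-Reasoning

    e*χ≈0 : ∀ {y} → y ∈ₛ C → e * χ y ≈ 0
    e*χ≈0 {y} y∈C = begin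
      e * χ y           ≈⟨ *-congˡ e (χ≈u*s y∈C) ⟩
      e * (u y * s)     ≡⟨ ℕ*.x∙yz≈y∙xz e (u y) s ⟩
      u y * (e * s)     ≡⟨ cong (u y *_) M≡[M/d]*d ⟨
      u y * M           ≈⟨ multiple≈0 (u y) ⟩
      0                 ∎
      where open ≈-Reasoning

    *χ-mod-e : ∀ a {y} → y ∈ₛ C → a * χ y ≈ (a % e) * χ y
    *χ-mod-e a {y} y∈C = begin
      a * χ y                                   ≡⟨ cong (_* χ y) (m≡m%n+[m/n]*n a e) ⟩
      (a % e + a / e * e) * χ y                 ≡⟨ *-distribʳ-+ (χ y) (a % e) (a / e * e) ⟩
      (a % e) * χ y + a / e * e * χ y           ≡⟨ cong ((a % e) * χ y +_) (*-assoc (a / e) e (χ y)) ⟩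
      (a % e) * χ y + a / e * (e * χ y)         ≈⟨ +-cong {(a % e) * χ y} refl (*-congˡ (a / e) (e*χ≈0 y∈C)) ⟩
      (a % e) * χ y + a / e * 0                 ≡⟨ cong ((a % e) * χ y +_) (*-zeroʳ (a / e)) ⟩
      (a % e) * χ y + 0                         ≡⟨ +-identityʳ _ ⟩
      (a % e) * χ y                             ∎
      where open ≈-Reasoning

    *s-residue : ∀ a → a * s % M ≡ (a % e) * s
    *s-residue a = trans (cong (_% M) a*s≡) (trans (+-multiple ((a % e) * s) (a / e)) (m<n⇒m%n≡m (subst ((a % e) * s <_) (sym M≡[M/d]*d) (*-monoˡ-< s (m%n<n a e)))))
      where
      a*s≡ : a * s ≡ (a % e) * s + a / e * M
      a*s≡ = begin
        a * s                           ≡⟨ cong (_* s) (m≡m%n+[m/n]*n a e) ⟩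
        (a % e + a / e * e) * s         ≡⟨ *-distribʳ-+ s (a % e) (a / e * e) ⟩
        (a % e) * s + a / e * e * s     ≡⟨ cong ((a % e) * s +_) (trans (*-assoc (a / e) e s) (cong (a / e *_) (sym M≡[M/d]*d))) ⟩
        (a % e) * s + a / e * M         ∎
        where open ≡-Reasoning

    *s-injective-mod-e : ∀ a b → a * s ≈ b * s → a % e ≡ b % e
    *s-injective-mod-e a b a*s≈b*s = *-cancelʳ-≡ (a % e) (b % e) s
      (trans (sym (*s-residue a)) (trans a*s≈b*s (*s-residue b)))

    u-additive : ∀ {x x′} → x ∈ₛ C → x′ ∈ₛ C → u (x ∙ x′) % e ≡ (u x + u x′) % e
    u-additive {x} {x′} x∈C x′∈C = *s-injective-mod-e (u (x ∙ x′)) (u x + u x′) (begin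
      u (x ∙ x′) * s          ≈⟨ χ≈u*s (mem-∙ C x∈C x′∈C) ⟨
      χ (x ∙ x′)              ≈⟨ homo χ-character {x} {x′} _ _ ⟩
      χ x + χ x′              ≈⟨ +-cong (χ≈u*s x∈C) (χ≈u*s x′∈C) ⟩
      u x * s + u x′ * s      ≡⟨ *-distribʳ-+ s (u x) (u x′) ⟨
      (u x + u x′) * s        ∎)
      where open ≈-Reasoning

    D : DecSubgroup
    D = characterKernel C χ-character

    card-D<card-C : card (mem D) < card (mem C)
    card-D<card-C = card-mono-< (proj₁ ∘ ∈-characterKernel⁻ C χ-character) g∈C λ g∈D →
      <⇒≢ s-positive (sym (trans (proj₂ (∈-characterKernel⁻ C χ-character g∈D)) 0%M≡0))

    π : Carrier → Carrier
    π x = x // u x · g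

    π∈D : ∀ {x} → x ∈ₛ C → π x ∈ₛ D
    π∈D {x} x∈C = ∈-characterKernel⁺ C χ-character (mem-// C x∈C (mem-· C (u x) g∈C)) (+-cancelʳ (χ x) (begin
      χ (π x) + χ x                 ≈⟨ +-cong {χ (π x)} refl χ[u·g]≈χ ⟨
      χ (π x) + χ (u x · g)         ≈⟨ hom-// χ-character {x} {u x · g} _ _ ⟩
      χ x                           ≡⟨ +-identityˡ (χ x) ⟨
      0 + χ x                       ∎))
      where
      open ≈-Reasoning
      χ[u·g]≈χ : χ (u x · g) ≈ χ x
      χ[u·g]≈χ = begin
        χ (u x · g)     ≈⟨ hom-· χ-character {g} _ (u x) ⟩
        u x * χ g       ≈⟨ *-congˡ (u x) (χ≈residue g) ⟩
        u x * s         ≈⟨ χ≈u*s x∈C ⟨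
        χ x             ∎

    π-∙ : ∀ {x x′} → x ∈ₛ C → x′ ∈ₛ C → π (x ∙ x′) ≡ π x ∙ π x′
    π-∙ {x} {x′} x∈C x′∈C = begin
      (x ∙ x′) // u (x ∙ x′) · g              ≡⟨ cong ((x ∙ x′) //_) (·g-mod-e (u (x ∙ x′))) ⟩
      (x ∙ x′) // (u (x ∙ x′) % e) · g        ≡⟨ cong (λ a → (x ∙ x′) // a · g) (u-additive x∈C x′∈C) ⟩
      (x ∙ x′) // ((u x + u x′) % e) · g      ≡⟨ cong ((x ∙ x′) //_) (·g-mod-e (u x + u x′)) ⟨
      (x ∙ x′) // (u x + u x′) · g            ≡⟨ cong ((x ∙ x′) //_) (×-homo-+ g (u x) (u x′)) ⟩
      (x ∙ x′) // (u x · g ∙ u x′ · g)        ≡⟨ //-∙-interchange x (u x · g) x′ (u x′ · g) ⟨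
      π x ∙ π x′                              ∎
      where open ≡-Reasoning

    u-D : ∀ {x} → x ∈ₛ D → u x ≡ 0
    u-D {x} x∈D = trans (cong (_/ s) (trans (proj₂ (∈-characterKernel⁻ C χ-character x∈D)) 0%M≡0)) (0/n≡0 s)

    π-D : ∀ {x} → x ∈ₛ D → π x ≡ x
    π-D {x} x∈D = trans (cong (λ a → x // a · g) (u-D x∈D)) (//-ε x)

    u-g : u g ≡ 1
    u-g = n/n≡1 s

    π-g : π g ≡ ε
    π-g = trans (cong (λ a → g // a · g) u-g) (trans (cong (g //_) (×-homo-1 g)) (inverseʳ g))

    extendPairing : PairingOn D → PairingOn C
    extendPairing PD = record
      { ⟨_,_⟩          = β
      ; linearˡ        = linearˡ
      ; linearʳ        = linearʳ
      ; nondegenerateʳ = nondegenerateʳ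
      }
      where
      module PD = PairingOn PD
      open ≈-Reasoning

      β : Carrier → Carrier → ℕ
      β x y = u x * χ y + PD.⟨ π x , π y ⟩

      linearˡ : ∀ {x x′ y} → x ∈ₛ C → x′ ∈ₛ C → y ∈ₛ C → β (x ∙ x′) y ≈ β x y + β x′ y
      linearˡ {x} {x′} {y} x∈C x′∈C y∈C = begin
        u (x ∙ x′) * χ y + PD.⟨ π (x ∙ x′) , π y ⟩
          ≈⟨ +-cong u-part (trans (cong (λ z → PD.⟨ z , π y ⟩ % M) (π-∙ x∈C x′∈C))
                                  (PD.linearˡ (π∈D x∈C) (π∈D x′∈C) (π∈D y∈C))) ⟩
        (u x * χ y + u x′ * χ y) + (PD.⟨ π x , π y ⟩ + PD.⟨ π x′ , π y ⟩)
          ≡⟨ ℕ+.interchange (u x * χ y) (u x′ * χ y) _ _ ⟩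
        β x y + β x′ y ∎
        where
        u-part : u (x ∙ x′) * χ y ≈ u x * χ y + u x′ * χ y
        u-part = begin
          u (x ∙ x′) * χ y              ≈⟨ *χ-mod-e (u (x ∙ x′)) y∈C ⟩
          (u (x ∙ x′) % e) * χ y        ≡⟨ cong (_* χ y) (u-additive x∈C x′∈C) ⟩
          ((u x + u x′) % e) * χ y      ≈⟨ *χ-mod-e (u x + u x′) y∈C ⟨
          (u x + u x′) * χ y            ≡⟨ *-distribʳ-+ (χ y) (u x) (u x′) ⟩
          u x * χ y + u x′ * χ y        ∎

      linearʳ : ∀ {x y y′} → x ∈ₛ C → y ∈ₛ C → y′ ∈ₛ C → β x (y ∙ y′) ≈ β x y + β x y′
      linearʳ {x} {y} {y′} x∈C y∈C y′∈C = begin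
        u x * χ (y ∙ y′) + PD.⟨ π x , π (y ∙ y′) ⟩
          ≈⟨ +-cong (trans (*-congˡ (u x) (homo χ-character {y} {y′} _ _)) (cong (_% M) (*-distribˡ-+ (u x) (χ y) (χ y′))))
                    (trans (cong (λ z → PD.⟨ π x , z ⟩ % M) (π-∙ y∈C y′∈C))
                           (PD.linearʳ (π∈D x∈C) (π∈D y∈C) (π∈D y′∈C))) ⟩
        (u x * χ y + u x * χ y′) + (PD.⟨ π x , π y ⟩ + PD.⟨ π x , π y′ ⟩)
          ≡⟨ ℕ+.interchange (u x * χ y) (u x * χ y′) _ _ ⟩
        β x y + β x y′ ∎

      nondegenerateʳ : ∀ {y} → y ∈ₛ C → y ≢ ε → ∃ λ x → x ∈ₛ C × ¬ (β x y ≈ 0)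
      nondegenerateʳ {y} y∈C y≢ε with χ y ≈? 0
      ... | no χy≉0 = g , g∈C , λ βgy≈0 → χy≉0 (begin
        χ y                                   ≡⟨ +-identityʳ (χ y) ⟨
        χ y + 0                               ≈⟨ +-cong {χ y} refl (hom-ε (pairingˡ-hom (π∈D y∈C))) ⟨
        χ y + PD.⟨ ε , π y ⟩                  ≡⟨ cong (_+ PD.⟨ ε , π y ⟩) (*-identityˡ (χ y)) ⟨
        1 * χ y + PD.⟨ ε , π y ⟩              ≡⟨ cong₂ (λ a z → a * χ y + PD.⟨ z , π y ⟩) u-g π-g ⟨
        β g y                                 ≈⟨ βgy≈0 ⟩
        0                                     ∎)
        where
        pairingˡ-hom : ∀ {z} → z ∈ₛ D → HomomorphismOn D (λ x → PD.⟨ x , z ⟩)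
        pairingˡ-hom z∈D = mkHomomorphismOn λ x∈D x′∈D → PD.linearˡ x∈D x′∈D z∈D
      ... | yes χy≈0 with x , x∈D , ⟨x,y⟩≉0 ← PD.nondegenerateʳ (∈-characterKernel⁺ C χ-character y∈C χy≈0) y≢ε =
        x , proj₁ (∈-characterKernel⁻ C χ-character x∈D) , λ βxy≈0 → ⟨x,y⟩≉0 (begin
          PD.⟨ x , y ⟩                        ≡⟨ cong₂ PD.⟨_,_⟩ (π-D x∈D) (π-D y∈D) ⟨
          PD.⟨ π x , π y ⟩                    ≡⟨ cong (λ a → a * χ y + PD.⟨ π x , π y ⟩) (u-D x∈D) ⟨
          β x y                               ≈⟨ βxy≈0 ⟩
          0                                   ∎)
        where
        y∈D : y ∈ₛ D
        y∈D = ∈-characterKernel⁺ C χ-character y∈C χy≈0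

  2≤order : ∀ {y} → y ≢ ε → 2 ≤ order y
  2≤order {y} y≢ε = ≰⇒> λ order≤1 → y≢ε (trans (sym (×-homo-1 y))
    (toWitness (subst (λ n → n · y ∈ₛ trivial) (≤-antisym order≤1 (s≤s z≤n)) (cosetOrder-· trivial y))))

  opaque
    splitOff : ∀ C {y₀} → y₀ ∈ₛ C → y₀ ≢ ε → ∃ λ D → card (mem D) < card (mem C) × (PairingOn D → PairingOn C)
    splitOff C {y₀} y₀∈C y₀≢ε = D , card-D<card-C , extendPairing
      where
      χ : Carrier → ℕ
      χ = proj₁ (largeCharacter C)
      χ-character : IsCharacter χ
      χ-character = proj₁ (proj₂ (largeCharacter C))
      order≤ : ∀ {x} → x ∈ₛ C → order x ≤ length (values C χ)
      order≤ = proj₂ (proj₂ (largeCharacter C))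

      y₁ : Carrier
      y₁ = argmax (residue χ) ε (members (mem C))

      y₁∈C : y₁ ∈ₛ C
      y₁∈C = argmax-all (residue χ) (mem-ε C) (All.tabulate (∈-members⁻ (mem C)))

      y₁-positive : 0 < residue χ y₁
      y₁-positive = n≢0⇒n>0 λ residue≡0 → <⇒≱ (≤-trans (2≤order y₀≢ε) (order≤ y₀∈C)) (|values|≤1 residue≡0)
        where
        |values|≤1 : residue χ y₁ ≡ 0 → length (values C χ) ≤ 1
        |values|≤1 residue≡0 = length-image≤ _≟ℕ_ {ys = 0 ∷ []} λ c∈ →
          let x , x∈ , c≡ = ∈-image⁻ _≟ℕ_ c∈
          in here (trans c≡ (n≤0⇒n≡0 (subst (residue χ x ≤_) residue≡0
                     (All.lookup (f[xs]≤f[argmax] {f = residue χ} ε (members (mem C))) x∈))))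

      positive : Carrier → Bool
      positive x = mem C x ∧ isYes (1 ≤? residue χ x)

      g : Carrier
      g = argmin (residue χ) y₁ (members positive)

      g-positive : T (positive g)
      g-positive = argmin-all (residue χ) (Equivalence.from T-∧ (y₁∈C , fromWitness y₁-positive))
                              (All.tabulate (∈-members⁻ positive))

      g∈C : g ∈ₛ C
      g∈C = proj₁ (Equivalence.to (T-∧ {mem C g}) g-positive)

      g-minimal : ∀ {x} → x ∈ₛ C → 0 < residue χ x → residue χ g ≤ residue χ x
      g-minimal x∈C 0<residue = All.lookup (f[argmin]≤f[xs] {f = residue χ} y₁ (members positive))
                                  (∈-members⁺ positive (Equivalence.from T-∧ (x∈C , fromWitness 0<residue)))

      open Split C χ-character order≤ g∈C (toWitness (proj₂ (Equivalence.to (T-∧ {mem C g}) g-positive))) g-minimal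

  trivialPairing : ∀ C → (∀ {y} → y ∈ₛ C → y ≡ ε) → PairingOn C
  trivialPairing C only-ε = record
    { ⟨_,_⟩          = λ _ _ → 0
    ; linearˡ        = λ _ _ _ → refl
    ; linearʳ        = λ _ _ _ → refl
    ; nondegenerateʳ = λ y∈C y≢ε → contradiction (only-ε y∈C) y≢ε
    }

  pairingOn-bounded : ∀ n C → card (mem C) ≤ n → PairingOn C
  pairingOn-bounded zero    C card≤0 = contradiction card≤0 (<⇒≱ (∈-length (∈-members⁺ (mem C) (mem-ε C))))
  pairingOn-bounded (suc n) C card≤n with any? (λ y → T? (mem C y) ×-dec ¬? (y ≟ ε)) elements
  ... | no none = trivialPairing C λ {y} y∈C → decidable-stable (y ≟ ε) λ y≢ε → none (lose (∈-elements y) (y∈C , y≢ε))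
  ... | yes some with y₀ , _ , y₀∈C , y₀≢ε ← find some
                 with D , card-D<card-C , extend ← splitOff C y₀∈C y₀≢ε =
    extend (pairingOn-bounded n D (≤-pred (≤-trans card-D<card-C card≤n)))

  selfPairing : Pairing
  selfPairing = record
    { ⟨_,_⟩          = ⟨_,_⟩
    ; linearˡ        = λ _ _ _ → linearˡ _ _ _
    ; linearʳ        = λ _ _ _ → linearʳ _ _ _
    ; nondegenerateʳ = λ y≢ε → let x , _ , ⟨x,y⟩≉0 = nondegenerateʳ _ y≢ε in x , ⟨x,y⟩≉0
    }
    where open PairingOn (pairingOn-bounded _ full ≤-refl)

module Powers where

  open import Algebra.Structures using (IsGroup)
  open import Algebra.Bundles using (Group)
  open import Data.Nat using (ℕ; zero; suc; _+_; _*_; _^_; _∸_; _≤_; _<_; _!)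
  open import Data.Nat.Properties using (n<1+n; m+[n∸m]≡n; m∸n≤m; ≤-trans; ≤-pred; <⇒≤; m<n⇒0<n∸m)
  open import Data.Nat.Divisibility using (divides; ∣-trans; m∣m*n; m≤n⇒m!∣n!)
  open import Data.Fin using (Fin; toℕ)
  import Data.Fin.Properties as Fin
  open import Data.Vec using (Vec; []; _∷_; zipWith; replicate)
  import Data.Vec as Vec
  import Data.Vec.Properties as Vec
  open import Data.List using (List; []; _∷_; map; concatMap; allFin; length)
  open import Data.List.Properties using (length-map; length-++; length-tabulate)
  open import Data.List.Membership.Propositional using (_∈_)
  open import Data.List.Membership.Propositional.Properties using (∈-allFin; ∈-map⁺; ∈-map⁻; ∈-concatMap⁺)
  open import Data.List.Relation.Unary.Any using (here)
  import Data.List.Relation.Unary.Any as Any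
  import Data.List.Relation.Unary.All as All
  import Data.List.Relation.Unary.All.Properties as All
  import Data.List.Relation.Unary.AllPairs as AllPairs
  import Data.List.Relation.Unary.AllPairs.Properties as AllPairs
  open import Data.List.Relation.Unary.Unique.Propositional using (Unique)
  import Data.List.Relation.Unary.Unique.Propositional.Properties as Unique
  open import Data.Product using (∃; _×_; _,_)
  open import Data.Empty using (⊥)
  open import Relation.Binary.PropositionalEquality
  open Counting
  open EnumeratedGroups
  open import Data.Bool using (true; false)
  open import Data.Fin.Subset using (Subset)
  open import Data.Maybe using (nothing)
  import Data.Maybe.Properties as Maybe

  ∈-allVecs : ∀ m n (v : Vec (Fin m) n) → v ∈ allVecs m n
  ∈-allVecs m zero    []      = here refl
  ∈-allVecs m (suc n) (a ∷ v) =
    ∈-concatMap⁺ (λ b → map (b ∷_) (allVecs m n)) (Any.map (λ { refl → ∈-map⁺ (a ∷_) (∈-allVecs m n v) }) (∈-allFin a))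

  allVecs-Unique : ∀ m n → Unique (allVecs m n)
  allVecs-Unique m zero    = All.[] AllPairs.∷ AllPairs.[]
  allVecs-Unique m (suc n) = Unique.concat⁺
    (All.map⁺ (All.tabulate λ _ → Unique.map⁺ (λ { refl → refl }) (allVecs-Unique m n)))
    (AllPairs.map⁺ (AllPairs.map disjoint (Unique.allFin⁺ m)))
    where
    disjoint : ∀ {a b} → a ≢ b → ∀ {v} → v ∈ map (a ∷_) (allVecs m n) × v ∈ map (b ∷_) (allVecs m n) → ⊥
    disjoint a≢b (v∈a , v∈b) with _ , _ , refl ← ∈-map⁻ _ v∈a | _ , _ , eq ← ∈-map⁻ _ v∈b = a≢b (Vec.∷-injectiveˡ eq)

  length-concatMap : ∀ {A B : Set} (f : A → List B) {k} → (∀ x → length (f x) ≡ k) →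
                     ∀ xs → length (concatMap f xs) ≡ length xs * k
  length-concatMap f fk []       = refl
  length-concatMap f fk (x ∷ xs) = trans (length-++ (f x)) (cong₂ _+_ (fk x) (length-concatMap f fk xs))

  length-allVecs : ∀ m n → length (allVecs m n) ≡ m ^ n
  length-allVecs m zero    = refl
  length-allVecs m (suc n) = trans
    (length-concatMap _ (λ a → trans (length-map (a ∷_) (allVecs m n)) (length-allVecs m n)) (allFin m))
    (cong (_* m ^ n) (length-tabulate {n = m} (λ i → i)))

  module _ (Γ : FiniteGroup) where
    open FiniteGroup Γ
    open IsGroup isGroup using (assoc; identityˡ; identityʳ; inverseˡ; inverseʳ)

    asEnumerated : EnumeratedGroup
    asEnumerated = record
      { Carrier = Fin order ; _≟_ = Fin._≟_ ; _∙_ = _∙_ ; ε = ε ; _⁻¹ = _⁻¹ ; isGroup = isGroup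
      ; elements = allFin order ; ∈-elements = ∈-allFin ; elements-Unique = Unique.allFin⁺ order }

    power : ℕ → EnumeratedGroup
    power n = record
      { Carrier         = Vec (Fin order) n
      ; _≟_             = Vec.≡-dec Fin._≟_
      ; _∙_             = zipWith _∙_
      ; ε               = replicate n ε
      ; _⁻¹             = Vec.map _⁻¹
      ; isGroup         = record
        { isMonoid = record
          { isSemigroup = record
            { isMagma = record { isEquivalence = isEquivalence ; ∙-cong = cong₂ (zipWith _∙_) }
            ; assoc   = Vec.zipWith-assoc assoc }
          ; identity = Vec.zipWith-identityˡ identityˡ , Vec.zipWith-identityʳ identityʳ }
        ; inverse = Vec.zipWith-inverseˡ inverseˡ , Vec.zipWith-inverseʳ inverseʳ
        ; ⁻¹-cong = cong (Vec.map _⁻¹) }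
      ; elements        = allVecs order n
      ; ∈-elements      = ∈-allVecs order n
      ; elements-Unique = allVecs-Unique order n
      }

    module _ where
      open EnumeratedGroup asEnumerated using (_·_; group)
      open Subgroups asEnumerated using (·-ε)
      open import Algebra.Properties.Monoid.Mult (Group.monoid group) using (×-homo-+; ×-assocˡ)
      open import Algebra.Properties.Group group using (∙-cancelˡ)

      pigeonhole-order : ∀ x → ∃ λ k → 0 < k × k ≤ order × k · x ≡ ε
      pigeonhole-order x with i , j , i<j , i·x≡j·x ← Fin.pigeonhole (n<1+n order) (λ i → toℕ i · x) =
        toℕ j ∸ toℕ i , m<n⇒0<n∸m i<j , ≤-trans (m∸n≤m (toℕ j) (toℕ i)) (≤-pred (Fin.toℕ<n j)) ,
        ∙-cancelˡ (toℕ i · x) _ ε (begin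
          (toℕ i · x) ∙ ((toℕ j ∸ toℕ i) · x)   ≡⟨ ×-homo-+ x (toℕ i) (toℕ j ∸ toℕ i) ⟨
          (toℕ i + (toℕ j ∸ toℕ i)) · x         ≡⟨ cong (_· x) (m+[n∸m]≡n (<⇒≤ i<j)) ⟩
          toℕ j · x                             ≡⟨ i·x≡j·x ⟨
          toℕ i · x                             ≡⟨ identityʳ _ ⟨
          (toℕ i · x) ∙ ε                       ∎)
        where open ≡-Reasoning

      exponent-annihilates : AnnihilatedBy asEnumerated (order !)
      exponent-annihilates x with suc k , _ , k≤order , k·x≡ε ← pigeonhole-order x
                             with divides q order!≡q*k ← ∣-trans (m∣m*n (k !)) (m≤n⇒m!∣n! k≤order) = begin
        (order !) · x     ≡⟨ cong (_· x) order!≡q*k ⟩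
        (q * suc k) · x   ≡⟨ ×-assocˡ x q (suc k) ⟨
        q · suc k · x     ≡⟨ cong (q ·_) k·x≡ε ⟩
        q · ε             ≡⟨ ·-ε q ⟩
        ε                 ∎
        where open ≡-Reasoning

    private
      _·ⁿ_ : ∀ {n} → ℕ → Vec (Fin order) n → Vec (Fin order) n
      _·ⁿ_ {n} = EnumeratedGroup._·_ (power n)

      ·ⁿ-[] : ∀ a → a ·ⁿ [] ≡ []
      ·ⁿ-[] a with a ·ⁿ []
      ... | [] = refl

      ·ⁿ-∷ : ∀ {n} a b (v : Vec (Fin order) n) → a ·ⁿ (b ∷ v) ≡ EnumeratedGroup._·_ asEnumerated a b ∷ a ·ⁿ v
      ·ⁿ-∷ zero    b v = refl
      ·ⁿ-∷ (suc a) b v = cong (zipWith _∙_ (b ∷ v)) (·ⁿ-∷ a b v)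

    power-annihilates : ∀ n → AnnihilatedBy (power n) (order !)
    power-annihilates zero    []      = ·ⁿ-[] (order !)
    power-annihilates (suc n) (b ∷ v) =
      trans (·ⁿ-∷ (order !) b v) (cong₂ _∷_ (exponent-annihilates b) (power-annihilates n v))

  module _ {A : Set} where

    project-zipWith : ∀ (f : A → A → A) {n} (S : Subset n) {a a′ b b′ : Vec A n} →
                      project S a ≡ project S a′ → project S b ≡ project S b′ →
                      project S (zipWith f a b) ≡ project S (zipWith f a′ b′)
    project-zipWith f []          {[]}    {[]}    {[]}    {[]}    _  _  = refl
    project-zipWith f (true  ∷ S) {_ ∷ a} {_ ∷ a′} {_ ∷ b} {_ ∷ b′} eq₁ eq₂
      with refl ← Maybe.just-injective (Vec.∷-injectiveˡ eq₁) | refl ← Maybe.just-injective (Vec.∷-injectiveˡ eq₂) =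
      cong (_ ∷_) (project-zipWith f S (Vec.∷-injectiveʳ eq₁) (Vec.∷-injectiveʳ eq₂))
    project-zipWith f (false ∷ S) {_ ∷ a} {_ ∷ a′} {_ ∷ b} {_ ∷ b′} eq₁ eq₂ =
      cong (nothing ∷_) (project-zipWith f S (Vec.∷-injectiveʳ eq₁) (Vec.∷-injectiveʳ eq₂))

    project-map : ∀ (g : A → A) {n} (S : Subset n) {a a′ : Vec A n} →
                  project S a ≡ project S a′ → project S (Vec.map g a) ≡ project S (Vec.map g a′)
    project-map g []          {[]}    {[]}     _  = refl
    project-map g (true  ∷ S) {_ ∷ a} {_ ∷ a′} eq with refl ← Maybe.just-injective (Vec.∷-injectiveˡ eq) =
      cong (_ ∷_) (project-map g S (Vec.∷-injectiveʳ eq))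
    project-map g (false ∷ S) {_ ∷ a} {_ ∷ a′} eq = cong (nothing ∷_) (project-map g S (Vec.∷-injectiveʳ eq))

module Projections (Γ : FiniteGroup) where

  open import Data.Bool using (true; false; T)
  open import Data.Nat using (ℕ; _*_; _^_; _≤_)
  open import Data.Nat.Properties using (≤-trans; ≤-reflexive)
  open import Data.Fin using (Fin)
  import Data.Fin.Properties as Fin
  open import Data.Fin.Subset using (Subset; ⊤; ∁; ∣_∣)
  open import Data.Maybe using (Maybe; just; nothing)
  import Data.Maybe.Properties as Maybe
  open import Data.Vec using (Vec; []; _∷_; zipWith; replicate)
  import Data.Vec as Vec
  import Data.Vec.Properties as Vec
  open import Data.List using (List; map; length)
  open import Data.List.Properties using (length-map)
  open import Data.List.Membership.Propositional using (_∈_)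
  open import Data.List.Membership.Propositional.Properties using (∈-map⁺)
  open import Data.Product using (∃; _×_; _,_)
  open import Function using (_⇔_; mk⇔)
  open import Relation.Binary.Definitions using (DecidableEquality)
  open import Relation.Binary.PropositionalEquality
  open Counting
  open EnumeratedGroups
  open Powers
  open FiniteGroup Γ using (order)
  open EnumeratedGroup (asEnumerated Γ) using (_∙_; ε; _⁻¹; inverseˡ; identityʳ; group)

  Pattern : ℕ → Set
  Pattern n = Vec (Maybe (Fin order)) n

  _≟P_ : ∀ {n} → DecidableEquality (Pattern n)
  _≟P_ = Vec.≡-dec (Maybe.≡-dec Fin._≟_)

  module _ {n : ℕ} where
    open Subgroups (power Γ n)

    toDec : Subgroup Γ n → DecSubgroup
    toDec H = record
      { mem = Subgroup.mem H ; mem-ε = Subgroup.mem-ε H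
      ; mem-∙ = λ {x} {y} → Subgroup.mem-∙ H x y ; mem-⁻¹ = λ {x} → Subgroup.mem-⁻¹ H x }

    fromDec : DecSubgroup → Subgroup Γ n
    fromDec K = record
      { mem = mem K ; mem-ε = mem-ε K ; mem-∙ = λ _ _ → mem-∙ K ; mem-⁻¹ = λ _ → mem-⁻¹ K }

  private
    _\\ⁿ_ : ∀ {n} → Vec (Fin order) n → Vec (Fin order) n → Vec (Fin order) n
    v \\ⁿ w = zipWith _∙_ (Vec.map _⁻¹ v) w

  project-cosets : ∀ {n} (S : Subset n) (v w : Vec (Fin order) n) →
                   project S v ≡ project S w ⇔ project S (v \\ⁿ w) ≡ project S (replicate n ε)
  project-cosets S v w = mk⇔ (to S v w) (from S v w)
    where
    open import Algebra.Properties.Group group using (\\-leftDividesˡ)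
    to : ∀ {n} (S : Subset n) v w → project S v ≡ project S w → project S (v \\ⁿ w) ≡ project S (replicate n ε)
    to []           []      []      _  = refl
    to (true  ∷ S) (a ∷ v) (b ∷ w) eq = cong₂ _∷_
      (cong just (trans (cong ((a ⁻¹) ∙_) (sym (Maybe.just-injective (Vec.∷-injectiveˡ eq)))) (inverseˡ a)))
      (to S v w (Vec.∷-injectiveʳ eq))
    to (false ∷ S) (a ∷ v) (b ∷ w) eq = cong (nothing ∷_) (to S v w (Vec.∷-injectiveʳ eq))
    from : ∀ {n} (S : Subset n) v w → project S (v \\ⁿ w) ≡ project S (replicate n ε) → project S v ≡ project S w
    from []           []      []      _  = refl
    from (true  ∷ S) (a ∷ v) (b ∷ w) eq = cong₂ _∷_
      (cong just (begin
        a              ≡⟨ identityʳ a ⟨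
        a ∙ ε          ≡⟨ cong (a ∙_) (Maybe.just-injective (Vec.∷-injectiveˡ eq)) ⟨
        a ∙ (a ⁻¹ ∙ b) ≡⟨ \\-leftDividesˡ a b ⟩
        b              ∎))
      (from S v w (Vec.∷-injectiveʳ eq))
      where open ≡-Reasoning
    from (false ∷ S) (a ∷ v) (b ∷ w) eq = cong (nothing ∷_) (from S v w (Vec.∷-injectiveʳ eq))

  module _ {n : ℕ} where
    open Subgroups (power Γ n)

    card-by-projection : ∀ K (S : Subset n) →
      card (mem K) ≡ card (kernelIn _≟P_ K (project S)) * length (image _≟P_ (project S) (members (mem K)))
    card-by-projection K S = card≡card-kernel*image _≟P_ K (project S) λ {v} {w} _ _ → project-cosets S v w

    project-⊤-injective : ∀ {m} {v w : Vec (Fin order) m} → project ⊤ v ≡ project ⊤ w → v ≡ w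
    project-⊤-injective {v = []}    {[]}    _  = refl
    project-⊤-injective {v = a ∷ v} {b ∷ w} eq =
      cong₂ _∷_ (Maybe.just-injective (Vec.∷-injectiveˡ eq)) (project-⊤-injective (Vec.∷-injectiveʳ eq))

    projSize-⊤ : ∀ H → projSize {Γ} {n} H ⊤ ≡ card (Subgroup.mem H)
    projSize-⊤ H = length-image-injective _≟P_ project-⊤-injective (members-Unique (Subgroup.mem H))

    projSize-factor≤ : ∀ (H : Subgroup Γ n) (S S′ : Subset n) (k : Pattern n → Pattern n) →
                       (∀ {v} → T (Subgroup.mem H v) → project S′ v ≡ k (project S v)) →
                       projSize H S′ ≤ projSize H S
    projSize-factor≤ H S S′ k factor = ≤-trans (length-image≤ _≟P_ image⊆) (≤-reflexive (length-map k (image _≟P_ (project S) L)))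
      where
      L : List (Vec (Fin order) n)
      L = members (Subgroup.mem H)
      image⊆ : ∀ {y} → y ∈ image _≟P_ (project S′) L → y ∈ map k (image _≟P_ (project S) L)
      image⊆ y∈ with v , v∈ , refl ← ∈-image⁻ _≟P_ y∈ =
        subst (_∈ map k (image _≟P_ (project S) L)) (sym (factor (∈-members⁻ (Subgroup.mem H) v∈)))
              (∈-map⁺ k (∈-image⁺ _≟P_ v∈))

  emb : ∀ {n} (S : Subset n) → Vec (Fin order) ∣ S ∣ → Vec (Fin order) n
  emb []          []      = []
  emb (true  ∷ S) (a ∷ u) = a ∷ emb S u
  emb (false ∷ S) u       = ε ∷ emb S u

  restrict : ∀ {n} (S : Subset n) → Vec (Fin order) n → Vec (Fin order) ∣ S ∣
  restrict []          []      = []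
  restrict (true  ∷ S) (a ∷ v) = a ∷ restrict S v
  restrict (false ∷ S) (a ∷ v) = restrict S v

  restrict-emb : ∀ {n} (S : Subset n) u → restrict S (emb S u) ≡ u
  restrict-emb []          []      = refl
  restrict-emb (true  ∷ S) (a ∷ u) = cong (a ∷_) (restrict-emb S u)
  restrict-emb (false ∷ S) u       = restrict-emb S u

  project-emb-restrict : ∀ {n} (S : Subset n) v → project S (emb S (restrict S v)) ≡ project S v
  project-emb-restrict []          []      = refl
  project-emb-restrict (true  ∷ S) (a ∷ v) = cong (just a ∷_) (project-emb-restrict S v)
  project-emb-restrict (false ∷ S) (a ∷ v) = cong (nothing ∷_) (project-emb-restrict S v)

  project-∁-emb : ∀ {n} (S : Subset n) u → project (∁ S) (emb S u) ≡ project (∁ S) (replicate n ε)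
  project-∁-emb []          []      = refl
  project-∁-emb (true  ∷ S) (a ∷ u) = cong (nothing ∷_) (project-∁-emb S u)
  project-∁-emb (false ∷ S) u       = cong (just ε ∷_) (project-∁-emb S u)

  emb-restrict : ∀ {n} (S : Subset n) v → project (∁ S) v ≡ project (∁ S) (replicate n ε) → emb S (restrict S v) ≡ v
  emb-restrict []          []      _  = refl
  emb-restrict (true  ∷ S) (a ∷ v) eq = cong (a ∷_) (emb-restrict S v (Vec.∷-injectiveʳ eq))
  emb-restrict (false ∷ S) (a ∷ v) eq =
    cong₂ _∷_ (sym (Maybe.just-injective (Vec.∷-injectiveˡ eq))) (emb-restrict S v (Vec.∷-injectiveʳ eq))

  large-projection-surjective : ∀ {n} (H : Subgroup Γ n) S → order ^ ∣ S ∣ ≤ projSize H S →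
                                ∀ u → ∃ λ v → T (Subgroup.mem H v) × project S (emb S u) ≡ project S v
  large-projection-surjective {n} H S large u =
    let v , v∈ , eq = ∈-image⁻ _≟P_ (patterns⊆image (∈-map⁺ patternOf (∈-allVecs order ∣ S ∣ u)))
    in v , ∈-members⁻ (Subgroup.mem H) v∈ , eq
    where
    open Subgroups (power Γ n)
    patternOf : Vec (Fin order) ∣ S ∣ → Pattern n
    patternOf u = project S (emb S u)
    patterns : List (Pattern n)
    patterns = map patternOf (allVecs order ∣ S ∣)
    img : List (Pattern n)
    img = image _≟P_ (project S) (members (Subgroup.mem H))
    image⊆patterns : ∀ {y} → y ∈ img → y ∈ patterns
    image⊆patterns y∈ with v , _ , refl ← ∈-image⁻ _≟P_ y∈ =
      subst (_∈ patterns) (project-emb-restrict S v) (∈-map⁺ patternOf (∈-allVecs order ∣ S ∣ (restrict S v)))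
    |patterns|≤|image| : length patterns ≤ length img
    |patterns|≤|image| = subst (_≤ length img) (sym (trans (length-map patternOf (allVecs order ∣ S ∣)) (length-allVecs order ∣ S ∣))) large
    patterns⊆image : ∀ {y} → y ∈ patterns → y ∈ img
    patterns⊆image = Unique-⊆-length≥⇒⊇ _≟P_ (image-Unique _≟P_ _) image⊆patterns |patterns|≤|image|

module Forward (Γ : FiniteGroup) where

  open import Data.Bool using (Bool; true; false; T)
  open import Data.Nat using (ℕ; _*_; _^_; _≤_; z≤n; s≤s; NonZero; >-nonZero)
  open import Data.Nat.Properties
  open import Data.Fin using (Fin)
  import Data.Fin.Properties as Fin
  open import Data.Fin.Subset using (Subset; ⊤; ∁)
  open import Data.Maybe using (just; nothing)
  open import Data.Vec using (Vec; []; _∷_)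
  import Data.Vec.Properties as Vec
  open import Data.List using (allFin)
  import Data.List as List
  open import Data.List.Relation.Unary.Any using (here)
  import Data.List.Relation.Unary.Unique.Propositional.Properties as Unique
  open import Data.List.Membership.Propositional.Properties using (∈-length)
  open import Data.Product using (_×_; _,_)
  open import Function using (Equivalence)
  open import Data.Bool.Properties using (T-∧)
  open import Relation.Nullary using (Dec)
  open import Relation.Nullary.Decidable using (isYes; toWitness; fromWitness; _×-dec_)
  open import Relation.Binary.PropositionalEquality
  open Counting
  open EnumeratedGroups
  open Powers
  open FiniteGroup Γ using (order)
  open EnumeratedGroup (asEnumerated Γ) using (_∙_; ε; _⁻¹; identityˡ; identityʳ; group)
  open Projections Γ
  open Subgroups (power Γ 3) using (DecSubgroup; card; members; members-Unique; ∈-members⁺; kernelIn; card≤1⇒only-ε)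
  open EnumeratedGroup (power Γ 3) using ()
    renaming (Carrier to Carrier³; _∙_ to _∙³_; _\\_ to _\\³_; ε to ε³; identityʳ to identityʳ³; group to group³)
  open import Algebra.Properties.Group group³ using (\\-leftDividesˡ)

  IsDiagonal : Vec (Fin order) 3 → Set
  IsDiagonal (a ∷ b ∷ c ∷ []) = a ≡ b × b ≡ c

  isDiagonal? : ∀ v → Dec (IsDiagonal v)
  isDiagonal? (a ∷ b ∷ c ∷ []) = (a Fin.≟ b) ×-dec (b Fin.≟ c)

  diagonal : Subgroup Γ 3
  diagonal = record
    { mem    = λ v → isYes (isDiagonal? v)
    ; mem-ε  = fromWitness (refl , refl)
    ; mem-∙  = mem-∙
    ; mem-⁻¹ = mem-⁻¹
    }
    where
    mem-∙ : ∀ v w → T (isYes (isDiagonal? v)) → T (isYes (isDiagonal? w)) → T (isYes (isDiagonal? (Data.Vec.zipWith _∙_ v w)))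
    mem-∙ (a ∷ b ∷ c ∷ []) (a′ ∷ b′ ∷ c′ ∷ []) p q
      with refl , refl ← toWitness {a? = isDiagonal? (a ∷ b ∷ c ∷ [])} p
         | refl , refl ← toWitness {a? = isDiagonal? (a′ ∷ b′ ∷ c′ ∷ [])} q = fromWitness (refl , refl)
    mem-⁻¹ : ∀ v → T (isYes (isDiagonal? v)) → T (isYes (isDiagonal? (Data.Vec.map _⁻¹ v)))
    mem-⁻¹ (a ∷ b ∷ c ∷ []) p with refl , refl ← toWitness {a? = isDiagonal? (a ∷ b ∷ c ∷ [])} p = fromWitness (refl , refl)

  ∅ S₁₂ S₂₃ S₁₃ : Subset 3
  ∅   = false ∷ false ∷ false ∷ []
  S₁₂ = true  ∷ true  ∷ false ∷ []
  S₂₃ = false ∷ true  ∷ true  ∷ []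
  S₁₃ = true  ∷ false ∷ true  ∷ []

  |diagonal| : ℕ
  |diagonal| = projSize diagonal ⊤

  order≤|diagonal| : order ≤ |diagonal|
  order≤|diagonal| = begin
    order                                 ≡⟨ length-tabulate {n = order} (λ i → i) ⟨
    List.length (allFin order)            ≤⟨ Unique-injection⇒length≤ (λ a → a ∷ a ∷ a ∷ []) Vec.∷-injectiveˡ (Unique.allFin⁺ order)
                                               (λ {a} _ → ∈-members⁺ (Subgroup.mem diagonal) (fromWitness {a? = isDiagonal? (a ∷ a ∷ a ∷ [])} (refl , refl))) ⟩
    card (Subgroup.mem diagonal)          ≡⟨ projSize-⊤ diagonal ⟨
    |diagonal|                            ∎
    where
    open ≤-Reasoning
    open import Data.List.Properties using (length-tabulate)

  projSize-∅ : projSize diagonal ∅ ≤ 1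
  projSize-∅ = length-image≤ _≟P_ {f = project ∅} {xs = members (Subgroup.mem diagonal)} {ys = List.[ nothing ∷ nothing ∷ nothing ∷ [] ]} λ y∈ →
    let v , _ , y≡ = ∈-image⁻ _≟P_ {f = project ∅} y∈ in here (trans y≡ (project-∅ v))
    where
    project-∅ : ∀ v → project ∅ v ≡ nothing ∷ nothing ∷ nothing ∷ []
    project-∅ (a ∷ b ∷ c ∷ []) = refl

  |diagonal|≤projSize : ∀ S (k : Pattern 3 → Pattern 3) →
                        (∀ a → project ⊤ (a ∷ a ∷ a ∷ []) ≡ k (project S (a ∷ a ∷ a ∷ []))) →
                        |diagonal| ≤ projSize diagonal S
  |diagonal|≤projSize S k recover = projSize-factor≤ diagonal S ⊤ k factor
    where
    factor : ∀ {v} → T (Subgroup.mem diagonal v) → project ⊤ v ≡ k (project S v)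
    factor {a ∷ b ∷ c ∷ []} p with refl , refl ← toWitness {a? = isDiagonal? (a ∷ b ∷ c ∷ [])} p = recover a

  instance
    |diagonal|≢0 : NonZero |diagonal|
    |diagonal|≢0 = >-nonZero (≤-trans (≤-trans (s≤s z≤n) (Fin.toℕ<n ε)) order≤|diagonal|)

  module _ (G : Subgroup Γ 3) (dual : DualIs diagonal G) where

    |G|≤|π₁₂G| : projSize G ⊤ ≤ projSize G S₁₂
    |G|≤|π₁₂G| = *-cancelʳ-≤ (projSize G ⊤) (projSize G S₁₂) |diagonal| (begin
      projSize G ⊤ * |diagonal|                 ≡⟨ dual ⊤ ⟩
      projSize diagonal ∅ * order ^ 3            ≤⟨ *-monoˡ-≤ (order ^ 3) projSize-∅ ⟩
      1 * order ^ 3                             ≡⟨ *-identityˡ (order ^ 3) ⟩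
      order * order ^ 2                         ≤⟨ *-monoˡ-≤ (order ^ 2) order≤|diagonal| ⟩
      |diagonal| * order ^ 2                    ≤⟨ *-monoˡ-≤ (order ^ 2) (|diagonal|≤projSize (∁ S₁₂) third λ _ → refl) ⟩
      projSize diagonal (∁ S₁₂) * order ^ 2     ≡⟨ dual S₁₂ ⟨
      projSize G S₁₂ * |diagonal|               ∎)
      where
      open ≤-Reasoning
      third : Pattern 3 → Pattern 3
      third (_ ∷ _ ∷ z ∷ []) = z ∷ z ∷ z ∷ []

    order²≤ : ∀ {S} → projSize G S * |diagonal| ≡ projSize diagonal (∁ S) * order ^ 2 →
              |diagonal| ≤ projSize diagonal (∁ S) → order ^ 2 ≤ projSize G S
    order²≤ {S} dualS large = *-cancelʳ-≤ (order ^ 2) (projSize G S) |diagonal| (begin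
      order ^ 2 * |diagonal|                    ≡⟨ *-comm (order ^ 2) |diagonal| ⟩
      |diagonal| * order ^ 2                    ≤⟨ *-monoˡ-≤ (order ^ 2) large ⟩
      projSize diagonal (∁ S) * order ^ 2       ≡⟨ dualS ⟨
      projSize G S * |diagonal|                 ∎)
      where open ≤-Reasoning

    π₁₂-kernel : Carrier³ → Bool
    π₁₂-kernel = kernelIn _≟P_ (toDec G) (project S₁₂)

    |π₁₂-kernel|≤1 : card π₁₂-kernel ≤ 1
    |π₁₂-kernel|≤1 = *-cancelʳ-≤ (card π₁₂-kernel) 1 (projSize G S₁₂) {{|π₁₂G|≢0}} (begin
      card π₁₂-kernel * projSize G S₁₂   ≡⟨ card-by-projection (toDec G) S₁₂ ⟨
      card (Subgroup.mem G)             ≡⟨ projSize-⊤ G ⟨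
      projSize G ⊤                      ≤⟨ |G|≤|π₁₂G| ⟩
      projSize G S₁₂                    ≡⟨ *-identityˡ _ ⟨
      1 * projSize G S₁₂                ∎)
      where
      open ≤-Reasoning
      |π₁₂G|≢0 : NonZero (projSize G S₁₂)
      |π₁₂G|≢0 = >-nonZero (≤-trans (∈-length (∈-members⁺ (Subgroup.mem G) (Subgroup.mem-ε G)))
                                    (≤-trans (≤-reflexive (sym (projSize-⊤ G))) |G|≤|π₁₂G|))

    π₁₂-injective : ∀ {v w} → T (Subgroup.mem G v) → T (Subgroup.mem G w) → project S₁₂ v ≡ project S₁₂ w → v ≡ w
    π₁₂-injective {v} {w} v∈G w∈G eq = begin
      v               ≡⟨ identityʳ³ v ⟨
      v ∙³ ε³         ≡⟨ cong (v ∙³_) v\\w≡ε ⟨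
      v ∙³ (v \\³ w)  ≡⟨ \\-leftDividesˡ v w ⟩
      w               ∎
      where
      open ≡-Reasoning
      v\\w≡ε : v \\³ w ≡ ε³
      v\\w≡ε = card≤1⇒only-ε (Equivalence.from T-∧ (Subgroup.mem-ε G , fromWitness refl)) |π₁₂-kernel|≤1
                 (Equivalence.from T-∧ (Subgroup.mem-∙ G _ _ (Subgroup.mem-⁻¹ G v v∈G) w∈G ,
                                        fromWitness (Equivalence.to (project-cosets S₁₂ v w) eq)))

    onto₂₃ : order ^ 2 ≤ projSize G S₂₃
    onto₂₃ = order²≤ (dual S₂₃) (|diagonal|≤projSize (∁ S₂₃) (λ { (z ∷ _ ∷ _ ∷ []) → z ∷ z ∷ z ∷ [] }) λ _ → refl)

    onto₁₃ : order ^ 2 ≤ projSize G S₁₃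
    onto₁₃ = order²≤ (dual S₁₃) (|diagonal|≤projSize (∁ S₁₃) (λ { (_ ∷ z ∷ _ ∷ []) → z ∷ z ∷ z ∷ [] }) λ _ → refl)

    commutes : ∀ x y → x ∙ y ≡ y ∙ x
    commutes x y
      with (a ∷ _ ∷ _ ∷ []) , v∈G , refl ← large-projection-surjective G S₂₃ onto₂₃ (ε ∷ x ∷ [])
         | (_ ∷ b ∷ _ ∷ []) , w∈G , refl ← large-projection-surjective G S₁₃ onto₁₃ (ε ∷ y ∷ [])
      = Vec.∷-injectiveˡ (Vec.∷-injectiveʳ (Vec.∷-injectiveʳ
          (π₁₂-injective (Subgroup.mem-∙ G _ _ v∈G w∈G) (Subgroup.mem-∙ G _ _ w∈G v∈G) same₁₂)))
      where
      same₁₂ : project S₁₂ ((a ∷ ε ∷ x ∷ []) ∙³ (ε ∷ b ∷ y ∷ [])) ≡ project S₁₂ ((ε ∷ b ∷ y ∷ []) ∙³ (a ∷ ε ∷ x ∷ []))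
      same₁₂ = cong₂ (λ p q → just p ∷ just q ∷ nothing ∷ [])
                     (trans (identityʳ a) (sym (identityˡ a))) (trans (identityˡ b) (sym (identityʳ b)))

  forward : ClosedUnderDuality Γ → IsAbelian Γ
  forward closed = let G , dual = closed 3 (s≤s z≤n) diagonal in commutes G dual

module Backward (Γ : FiniteGroup) (abelian : IsAbelian Γ) where

  open import Data.Bool using (Bool; true; false; T)
  open import Data.Nat using (ℕ; suc; _+_; _*_; _^_; _%_; _!; NonZero; >-nonZero)
  open import Data.Nat.Properties using (_!≢0; +-identityʳ; +-commutativeSemigroup; *-commutativeSemigroup; ≤-antisym; *-comm; *-cancelˡ-≡; module ≤-Reasoning)
  import Algebra.Properties.CommutativeSemigroup *-commutativeSemigroup as ℕ*
  open import Data.List using (List; map; length)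
  open import Data.List.Properties using (length-map)
  open import Data.List.Membership.Propositional.Properties using (∈-map⁺; ∈-length)
  open import Data.Bool.Properties using (T-∧)
  import Algebra.Properties.CommutativeSemigroup +-commutativeSemigroup as ℕ+
  open import Data.Fin using (Fin)
  import Data.Fin.Properties as Fin
  open import Data.Fin.Subset using (Subset; ⊤; ∁; ∣_∣)
  open import Data.Maybe using (just; nothing)
  open import Data.Vec using (Vec; []; _∷_; replicate; zipWith)
  import Data.Vec as Vec
  import Data.Vec.Properties as Vec
  import Data.Maybe.Properties as Maybe
  open import Data.Product using (∃; _×_; _,_; proj₂)
  open import Relation.Nullary using (¬_; yes; no; contradiction)
  open import Function using (_∘_; Equivalence)
  open import Data.List.Membership.Propositional using (_∈_; find)
  import Data.List.Relation.Unary.Any as Any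
  open import Data.List.Relation.Unary.Any using (any?)
  open import Relation.Nullary.Decidable using (isYes; toWitness; fromWitness)
  open import Relation.Binary.PropositionalEquality
  open Counting
  open EnumeratedGroups
  open ModularArithmetic
  open Powers
  open FiniteGroup Γ using (order)
  open Projections Γ

  M : ℕ
  M = order !

  instance
    M≢0 : NonZero M
    M≢0 = order !≢0

  open Modulo M

  private
    Γᴱ : EnumeratedGroup
    Γᴱ = asEnumerated Γ
    module Γᴱ = EnumeratedGroup Γᴱ
    open Γᴱ using (_∙_; ε)

  β : Characters.Pairing Γᴱ abelian M (exponent-annihilates Γ)
  β = SelfDual.selfPairing Γᴱ abelian M (exponent-annihilates Γ)

  open Characters.Pairing β renaming (⟨_,_⟩ to ⟪_,_⟫; linearˡ to βlinearˡ; linearʳ to βlinearʳ; nondegenerateʳ to βnondegenerateʳ)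

  ⟨_,_⟩ⁿ : ∀ {n} → Vec (Fin order) n → Vec (Fin order) n → ℕ
  ⟨ []    , []    ⟩ⁿ = 0
  ⟨ a ∷ x , b ∷ y ⟩ⁿ = ⟪ a , b ⟫ + ⟨ x , y ⟩ⁿ

  private
    module Cᴱ = Characters Γᴱ abelian M (exponent-annihilates Γ)

    βʳ-hom : ∀ a → Cᴱ.HomomorphismOn (Subgroups.full Γᴱ) ⟪ a ,_⟫
    βʳ-hom a = Cᴱ.mkHomomorphismOn λ {b} {b′} _ _ → βlinearʳ a b b′

    βˡ-hom : ∀ b → Cᴱ.HomomorphismOn (Subgroups.full Γᴱ) (λ a → ⟪ a , b ⟫)
    βˡ-hom b = Cᴱ.mkHomomorphismOn λ {a} {a′} _ _ → βlinearˡ a a′ b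

  ⟨ε,-⟩ⁿ≈0 : ∀ {n} (y : Vec (Fin order) n) → ⟨ replicate n ε , y ⟩ⁿ ≈ 0
  ⟨ε,-⟩ⁿ≈0 []      = refl
  ⟨ε,-⟩ⁿ≈0 (b ∷ y) = +-cong (Cᴱ.hom-ε (βˡ-hom b)) (⟨ε,-⟩ⁿ≈0 y)

  linearˡⁿ : ∀ {n} (x x′ y : Vec (Fin order) n) → ⟨ zipWith _∙_ x x′ , y ⟩ⁿ ≈ ⟨ x , y ⟩ⁿ + ⟨ x′ , y ⟩ⁿ
  linearˡⁿ []       []         []       = refl
  linearˡⁿ (a ∷ x) (a′ ∷ x′) (b ∷ y) = trans (+-cong (βlinearˡ a a′ b) (linearˡⁿ x x′ y))
                                            (cong (_% M) (ℕ+.interchange ⟪ a , b ⟫ ⟪ a′ , b ⟫ ⟨ x , y ⟩ⁿ ⟨ x′ , y ⟩ⁿ))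

  linearʳⁿ : ∀ {n} (x y y′ : Vec (Fin order) n) → ⟨ x , zipWith _∙_ y y′ ⟩ⁿ ≈ ⟨ x , y ⟩ⁿ + ⟨ x , y′ ⟩ⁿ
  linearʳⁿ []       []       []         = refl
  linearʳⁿ (a ∷ x) (b ∷ y) (b′ ∷ y′) = trans (+-cong (βlinearʳ a b b′) (linearʳⁿ x y y′))
                                            (cong (_% M) (ℕ+.interchange ⟪ a , b ⟫ ⟪ a , b′ ⟫ ⟨ x , y ⟩ⁿ ⟨ x , y′ ⟩ⁿ))

  nondegenerateʳⁿ : ∀ {n} {y : Vec (Fin order) n} → y ≢ replicate n ε → ∃ λ x → ¬ (⟨ x , y ⟩ⁿ ≈ 0)
  nondegenerateʳⁿ {y = []}    y≢ε = contradiction refl y≢ε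
  nondegenerateʳⁿ {suc n} {y = b ∷ y} b∷y≢ε with b Fin.≟ ε
  ... | no b≢ε with a , ⟪a,b⟫≉0 ← βnondegenerateʳ b≢ε =
    a ∷ replicate n ε , λ ⟨x,y⟩≈0 → ⟪a,b⟫≉0 (begin
      ⟪ a , b ⟫                               ≡⟨ +-identityʳ _ ⟨
      ⟪ a , b ⟫ + 0                           ≈⟨ +-cong {⟪ a , b ⟫} refl (⟨ε,-⟩ⁿ≈0 y) ⟨
      ⟪ a , b ⟫ + ⟨ replicate n ε , y ⟩ⁿ      ≈⟨ ⟨x,y⟩≈0 ⟩
      0                                       ∎)
    where open ≈-Reasoning
  ... | yes refl with x , ⟨x,y⟩≉0 ← nondegenerateʳⁿ {y = y} (b∷y≢ε ∘ cong (ε ∷_)) =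
    ε ∷ x , λ ⟨ε∷x,ε∷y⟩≈0 → ⟨x,y⟩≉0 (trans (+-cong {0} {⟪ ε , ε ⟫} (sym (Cᴱ.hom-ε (βˡ-hom ε))) refl) ⟨ε∷x,ε∷y⟩≈0)

  powerPairing : ∀ n → Characters.Pairing (power Γ n) (Vec.zipWith-comm abelian) M (power-annihilates Γ n)
  powerPairing n = record
    { ⟨_,_⟩ = ⟨_,_⟩ⁿ ; linearˡ = linearˡⁿ ; linearʳ = linearʳⁿ ; nondegenerateʳ = nondegenerateʳⁿ }

  pairing-agrees : ∀ {n} (S : Subset n) {x h y : Vec (Fin order) n} →
                   project (∁ S) h ≡ project (∁ S) x → project S y ≡ project S (replicate n ε) →
                   ⟨ x , y ⟩ⁿ ≈ ⟨ h , y ⟩ⁿ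
  pairing-agrees []          {[]}    {[]}    {[]}    _     _    = refl
  pairing-agrees (true  ∷ S) {a ∷ x} {c ∷ h} {b ∷ y} h≡x   y≡ε with refl ← Maybe.just-injective (Vec.∷-injectiveˡ y≡ε) =
    +-cong (trans (Cᴱ.hom-ε (βʳ-hom a)) (sym (Cᴱ.hom-ε (βʳ-hom c))))
           (pairing-agrees S (Vec.∷-injectiveʳ h≡x) (Vec.∷-injectiveʳ y≡ε))
  pairing-agrees (false ∷ S) {a ∷ x} {c ∷ h} {b ∷ y} h≡x   y≡ε with refl ← Maybe.just-injective (Vec.∷-injectiveˡ h≡x) =
    +-cong {⟪ a , b ⟫} refl (pairing-agrees S (Vec.∷-injectiveʳ h≡x) (Vec.∷-injectiveʳ y≡ε))

  private
    orthogonal-tail : ∀ {n} {s} {S : Subset n} {b} {y : Vec (Fin order) n} →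
      (∀ x → project (∁ (s ∷ S)) x ≡ project (∁ (s ∷ S)) (replicate (suc n) ε) → ⟨ x , b ∷ y ⟩ⁿ ≈ 0) →
      ∀ x → project (∁ S) x ≡ project (∁ S) (replicate n ε) → ⟨ x , y ⟩ⁿ ≈ 0
    orthogonal-tail {b = b} ⊥supported x supported =
      trans (+-cong {0} {⟪ ε , b ⟫} (sym (Cᴱ.hom-ε (βˡ-hom b))) refl) (⊥supported (ε ∷ x) (cong (_ ∷_) supported))

  orthogonal-to-supported : ∀ {n} (S : Subset n) (y : Vec (Fin order) n) →
    (∀ x → project (∁ S) x ≡ project (∁ S) (replicate n ε) → ⟨ x , y ⟩ⁿ ≈ 0) →
    project S y ≡ project S (replicate n ε)
  orthogonal-to-supported []          []      _ = refl
  orthogonal-to-supported {suc n} (true ∷ S) (b ∷ y) ⊥supported with b Fin.≟ ε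
  ... | yes refl = cong (just ε ∷_) (orthogonal-to-supported S y (orthogonal-tail ⊥supported))
  ... | no  b≢ε with a , ⟪a,b⟫≉0 ← βnondegenerateʳ b≢ε = contradiction (begin
    ⟪ a , b ⟫                               ≡⟨ +-identityʳ _ ⟨
    ⟪ a , b ⟫ + 0                           ≈⟨ +-cong {⟪ a , b ⟫} refl (⟨ε,-⟩ⁿ≈0 y) ⟨
    ⟪ a , b ⟫ + ⟨ replicate n ε , y ⟩ⁿ      ≈⟨ ⊥supported (a ∷ replicate n ε) (cong (nothing ∷_) refl) ⟩
    0                                       ∎) ⟪a,b⟫≉0
    where open ≈-Reasoning
  orthogonal-to-supported (false ∷ S) (b ∷ y) ⊥supported =
    cong (nothing ∷_) (orthogonal-to-supported S y (orthogonal-tail ⊥supported))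

  module _ {n : ℕ} (H : Subgroup Γ n) where
    open Subgroups (power Γ n)
    open Duality (power Γ n) (Vec.zipWith-comm abelian) M (power-annihilates Γ n) (powerPairing n)
    open EnumeratedGroup (power Γ n) using () renaming (ε to εⁿ; _∙_ to _∙ⁿ_; _⁻¹ to _⁻¹ⁿ)

    K : DecSubgroup
    K = toDec H

    dualSubgroup : Subgroup Γ n
    dualSubgroup = fromDec (K ᗮ)

    module _ (S : Subset n) where

      supported : Vec (Fin order) n → Bool
      supported x = isYes (project (∁ S) x ≟P project (∁ S) εⁿ)

      -- W below is H + V_S, with V_S the vectors supported on S.
      agreesWithH : Vec (Fin order) n → Bool
      agreesWithH x = isYes (any? (λ h → project (∁ S) h ≟P project (∁ S) x) (members (mem K)))

      agreesWithH-intro : ∀ {h x} → h ∈ₛ K → project (∁ S) h ≡ project (∁ S) x → T (agreesWithH x)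
      agreesWithH-intro h∈K eq = fromWitness (Any.map (λ { refl → eq }) (∈-members⁺ (mem K) h∈K))

      agreesWithH-elim : ∀ {x} → T (agreesWithH x) → ∃ λ h → h ∈ₛ K × project (∁ S) h ≡ project (∁ S) x
      agreesWithH-elim p with h , h∈ , eq ← find (toWitness p) = h , ∈-members⁻ (mem K) h∈ , eq

      W : DecSubgroup
      W = record
        { mem    = agreesWithH
        ; mem-ε  = agreesWithH-intro (mem-ε K) refl
        ; mem-∙  = λ p q →
            let h , h∈K , eq = agreesWithH-elim p ; h′ , h′∈K , eq′ = agreesWithH-elim q
            in agreesWithH-intro (mem-∙ K h∈K h′∈K) (project-zipWith _∙_ (∁ S) eq eq′)
        ; mem-⁻¹ = λ p →
            let h , h∈K , eq = agreesWithH-elim p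
            in agreesWithH-intro (mem-⁻¹ K h∈K) (project-map _ (∁ S) eq)
        }

      K⊆W : ∀ {x} → x ∈ₛ K → x ∈ₛ W
      K⊆W x∈K = agreesWithH-intro x∈K refl

      supported⊆W : ∀ {x} → T (supported x) → x ∈ₛ W
      supported⊆W x-supported = agreesWithH-intro (mem-ε K) (sym (toWitness x-supported))

      card-supported : card supported ≡ order ^ ∣ S ∣
      card-supported = ≤-antisym
        (begin
          card supported                         ≤⟨ Unique-⊆⇒length≤ (members-Unique supported) supported⊆embedded ⟩
          length (map (emb S) (allVecs order ∣ S ∣)) ≡⟨ length-map (emb S) (allVecs order ∣ S ∣) ⟩
          length (allVecs order ∣ S ∣)           ≡⟨ length-allVecs order ∣ S ∣ ⟩
          order ^ ∣ S ∣                          ∎)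
        (begin
          order ^ ∣ S ∣                          ≡⟨ length-allVecs order ∣ S ∣ ⟨
          length (allVecs order ∣ S ∣)           ≤⟨ Unique-injection⇒length≤ (emb S) emb-injective (allVecs-Unique order ∣ S ∣)
                                                      (λ {u} _ → ∈-members⁺ supported (fromWitness (project-∁-emb S u))) ⟩
          card supported                         ∎)
        where
        open ≤-Reasoning
        supported⊆embedded : ∀ {x} → x ∈ members supported → x ∈ map (emb S) (allVecs order ∣ S ∣)
        supported⊆embedded {x} x∈ = subst (_∈ map (emb S) (allVecs order ∣ S ∣))
          (emb-restrict S x (toWitness (∈-members⁻ supported x∈))) (∈-map⁺ (emb S) (∈-allVecs order ∣ S ∣ (restrict S x)))
        emb-injective : ∀ {u u′} → emb S u ≡ emb S u′ → u ≡ u′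
        emb-injective {u} {u′} eq = trans (sym (restrict-emb S u)) (trans (cong (restrict S) eq) (restrict-emb S u′))

      card-W : card (mem W) ≡ projSize H (∁ S) * order ^ ∣ S ∣
      card-W = begin
        card (mem W)                                                   ≡⟨ card-by-projection W (∁ S) ⟩
        card (kernelIn _≟P_ W (project (∁ S))) * length imageW         ≡⟨ cong₂ _*_ kernel≡supported imageW≡imageH ⟩
        card supported * projSize H (∁ S)                              ≡⟨ cong (_* projSize H (∁ S)) card-supported ⟩
        order ^ ∣ S ∣ * projSize H (∁ S)                               ≡⟨ *-comm (order ^ ∣ S ∣) (projSize H (∁ S)) ⟩
        projSize H (∁ S) * order ^ ∣ S ∣                               ∎
        where
        open ≡-Reasoning
        imageW : List (Pattern n)
        imageW = image _≟P_ (project (∁ S)) (members (mem W))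
        imageH : List (Pattern n)
        imageH = image _≟P_ (project (∁ S)) (members (mem K))
        kernel≡supported : card (kernelIn _≟P_ W (project (∁ S))) ≡ card supported
        kernel≡supported = card-cong (proj₂ ∘ Equivalence.to T-∧)
          (λ x-supported → Equivalence.from T-∧ (supported⊆W x-supported , x-supported))
        imageW≡imageH : length imageW ≡ length imageH
        imageW≡imageH = Unique-⊆-⊇⇒length≡ (image-Unique _≟P_ _) (image-Unique _≟P_ _)
          (λ y∈ → let x , x∈ , y≡ = ∈-image⁻ _≟P_ y∈
                      h , h∈K , h≡x = agreesWithH-elim (∈-members⁻ (mem W) x∈)
                  in subst (_∈ imageH) (sym (trans y≡ (sym h≡x))) (∈-image⁺ _≟P_ (∈-members⁺ (mem K) h∈K)))
          (λ y∈ → let h , h∈ , y≡ = ∈-image⁻ _≟P_ y∈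
                  in subst (_∈ imageW) (sym y≡) (∈-image⁺ _≟P_ (∈-members⁺ (mem W) (K⊆W (∈-members⁻ (mem K) h∈)))))

      kernel≡Wᗮ : card (kernelIn _≟P_ (K ᗮ) (project S)) ≡ card (mem (W ᗮ))
      kernel≡Wᗮ = card-cong
        (λ p → let y∈Kᗮ , y-on-S = Equivalence.to T-∧ p in
          orthogonal-intro W λ x∈W → let h , h∈K , h≡x = agreesWithH-elim x∈W in
            trans (pairing-agrees S h≡x (toWitness y-on-S)) (orthogonal-elim K y∈Kᗮ h∈K))
        (λ {y} y∈Wᗮ → Equivalence.from T-∧ (ᗮ-antitone K W K⊆W y∈Wᗮ ,
          fromWitness (orthogonal-to-supported S y λ x x-supported →
            orthogonal-elim W y∈Wᗮ (supported⊆W (fromWitness x-supported)))))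

      dual-identity : projSize dualSubgroup S * projSize H ⊤ ≡ projSize H (∁ S) * order ^ ∣ S ∣
      dual-identity = begin
        p * projSize H ⊤            ≡⟨ cong (p *_) (projSize-⊤ H) ⟩
        p * card (mem K)            ≡⟨ *-cancelˡ-≡ (p * card (mem K)) (card (mem W)) k (begin
            k * (p * card (mem K))      ≡⟨ ℕ*.x∙yz≈z∙xy k p (card (mem K)) ⟩
            card (mem K) * (k * p)      ≡⟨ cong (card (mem K) *_) (trans (card-by-projection (K ᗮ) S) (cong (_* p) kernel≡Wᗮ)) ⟨
            card (mem K) * card (mem (K ᗮ)) ≡⟨ duality K ⟩
            card (mem full)             ≡⟨ duality W ⟨
            card (mem W) * k            ≡⟨ *-comm (card (mem W)) k ⟩
            k * card (mem W)            ∎) ⟩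
        card (mem W)                ≡⟨ card-W ⟩
        projSize H (∁ S) * order ^ ∣ S ∣ ∎
        where
        open ≡-Reasoning
        p : ℕ
        p = projSize dualSubgroup S
        k : ℕ
        k = card (mem (W ᗮ))
        instance
          k≢0 : NonZero k
          k≢0 = >-nonZero (∈-length (∈-members⁺ (mem (W ᗮ)) (mem-ε (W ᗮ))))

  backward : ClosedUnderDuality Γ
  backward n _ H = dualSubgroup H , dual-identity H

theorem9p22 : (Γ : FiniteGroup) → ClosedUnderDuality Γ ⇔ IsAbelian Γ
theorem9p22 Γ = mk⇔ (Forward.forward Γ) (Backward.backward Γ)
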